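{- Let $G$ be a subcubic graph, $\pi=\{V_1,\dots,V_k\}$ a connected coalition partition of $G$, and $H=CCG(G,\pi)$. If $k\ge 6$, then $H$ is isomorphic to one of the graphs $M_6$, $3K_2$, $S_{2,2}$, $S_k$.
   Context: Graphs are finite and simple. A graph is subcubic if it is connected and its maximum vertex degree is at most 3. $G[S]$ is the induced subgraph. A set $D\subseteq V$ is dominating if every vertex of $V\setminus D$ has a neighbour in $D$; connected dominating if moreover $G[D]$ is connected. Two disjoint subsets $A,B\subseteq V$ form a connected coalition if neither is a connected dominating set but $A\cup B$ is. A connected coalition partition of $G$ is a partition $\pi=\{V_1,\dots,V_k\}$ of $V$ such that each $V_i$ either is a connected dominating set consisting of a single vertex or forms a connected coalition with some set of $\pi$. The coalition graph $CCG(G,\pi)$ has vertex set $\{V_1,\dots,V_k\}$, with $V_i\sim V_j$ iff they form a connected coalition. Notation: $M_6$ is the Möbius ladder on 6 vertices ($C_6$ plus the three edges joining opposite vertices), isomorphic to $K_{3,3}$; $3K_2$ is three disjoint edges; $S_k$ is the star of order $k$ ($K_{1,k-1}$); $S_{2,2}$ is the double star on 6 vertices: two adjacent vertices each having exactly two further pendant neighbours. -}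

module Defs where

open import Data.Nat using (ℕ; zero; suc; _≤_; _+_; ∣_-_∣; _≡ᵇ_)
open import Data.Bool using (Bool; true; false; if_then_else_; _∨_; _∧_; not; T)
open import Data.Fin using (Fin; toℕ)
open import Data.List using (List; map; allFin)
open import Data.Nat.ListAction using (sum)
open import Data.Product using (Σ; ∃; _×_; _,_)
open import Data.Sum using (_⊎_)
open import Relation.Binary.PropositionalEquality using (_≡_; _≢_)
open import Relation.Nullary using (¬_)
open import Relation.Unary using (Pred; _∈_; _∉_; _∪_)
open import Level using (0ℓ)
open import Function.Bundles using (_⤖_; _⇔_; Bijection)

record Graph (n : ℕ) : Set where
  field
    E      : Fin n → Fin n → Bool
    E-sym  : ∀ u v → E u v ≡ E v u
    E-irr  : ∀ u → E u u ≡ false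
open Graph public

VSet : ℕ → Set₁
VSet n = Pred (Fin n) 0ℓ

module _ {n : ℕ} (G : Graph n) where

  Adj : Fin n → Fin n → Set
  Adj u v = E G u v ≡ true

  deg : Fin n → ℕ
  deg u = sum (map (λ v → if E G u v then 1 else 0) (allFin n))

  data Walk (S : VSet n) : Fin n → Fin n → Set where
    here : ∀ {u} → u ∈ S → Walk S u u
    step : ∀ {u v w} → u ∈ S → Adj u v → Walk S v w → Walk S u w

  InducedConnected : VSet n → Set
  InducedConnected S = (∃ λ u → u ∈ S) × (∀ u v → u ∈ S → v ∈ S → Walk S u v)

  Dominating : VSet n → Set
  Dominating D = ∀ v → v ∉ D → ∃ λ u → u ∈ D × Adj u v

  ConnDominating : VSet n → Set
  ConnDominating D = Dominating D × InducedConnected D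

  Full : VSet n
  Full _ = Data.Unit.⊤ where import Data.Unit

  Connected : Set
  Connected = InducedConnected Full

  Subcubic : Set
  Subcubic = Connected × (∀ u → deg u ≤ 3)

  ConnCoalition : VSet n → VSet n → Set
  ConnCoalition A B = ¬ ConnDominating A × ¬ ConnDominating B × ConnDominating (A ∪ B)

  module _ {k : ℕ} (part : Fin n → Fin k) where
    Class : Fin k → VSet n
    Class i v = part v ≡ i

    Singleton : VSet n → Set
    Singleton S = ∃ λ v → ∀ u → (u ∈ S ⇔ u ≡ v)

    IsCCPartition : Set
    IsCCPartition =
      (∀ i → ∃ λ v → v ∈ Class i) ×
      (∀ i → (ConnDominating (Class i) × Singleton (Class i))
             ⊎ (∃ λ j → ConnCoalition (Class i) (Class j)))

    CCG : Fin k → Fin k → Set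
    CCG i j = i ≢ j × ConnCoalition (Class i) (Class j)

_≅_ : ∀ {a b} → (Fin a → Fin a → Set) → (Fin b → Fin b → Set) → Set
_≅_ {a} {b} R S = Σ (Fin a ⤖ Fin b) λ f →
  ∀ i j → (R i j ⇔ S (Bijection.to f i) (Bijection.to f j))

-- Möbius ladder M6: cycle 0-1-2-3-4-5-0 plus the opposite pairs {i, i+3};
-- i.e. |i - j| ∈ {1, 3, 5}
M6 : Fin 6 → Fin 6 → Set
M6 i j = T (let d = ∣ toℕ i - toℕ j ∣ in (d ≡ᵇ 1) ∨ (d ≡ᵇ 3) ∨ (d ≡ᵇ 5))

ThreeK2 : Fin 6 → Fin 6 → Set
ThreeK2 i j = T (let a = toℕ i ; b = toℕ j in
  ((a ≡ᵇ 0) ∧ (b ≡ᵇ 1)) ∨ ((a ≡ᵇ 1) ∧ (b ≡ᵇ 0)) ∨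
  ((a ≡ᵇ 2) ∧ (b ≡ᵇ 3)) ∨ ((a ≡ᵇ 3) ∧ (b ≡ᵇ 2)) ∨
  ((a ≡ᵇ 4) ∧ (b ≡ᵇ 5)) ∨ ((a ≡ᵇ 5) ∧ (b ≡ᵇ 4)))

S22 : Fin 6 → Fin 6 → Set
S22 i j = T (let a = toℕ i ; b = toℕ j in
  ((a ≡ᵇ 0) ∧ (b ≡ᵇ 1)) ∨ ((a ≡ᵇ 1) ∧ (b ≡ᵇ 0)) ∨
  ((a ≡ᵇ 0) ∧ (b ≡ᵇ 2)) ∨ ((a ≡ᵇ 2) ∧ (b ≡ᵇ 0)) ∨
  ((a ≡ᵇ 0) ∧ (b ≡ᵇ 3)) ∨ ((a ≡ᵇ 3) ∧ (b ≡ᵇ 0)) ∨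
  ((a ≡ᵇ 1) ∧ (b ≡ᵇ 4)) ∨ ((a ≡ᵇ 4) ∧ (b ≡ᵇ 1)) ∨
  ((a ≡ᵇ 1) ∧ (b ≡ᵇ 5)) ∨ ((a ≡ᵇ 5) ∧ (b ≡ᵇ 1)))

-- star S_k of order k (K_{1,k-1}): centre 0 adjacent to every other vertex
Star : (k : ℕ) → Fin k → Fin k → Set
Star k i j = T (not (toℕ i ≡ᵇ toℕ j) ∧ ((toℕ i ≡ᵇ 0) ∨ (toℕ j ≡ᵇ 0)))

-- A connected dominating set D of a graph of maximum degree 3 satisfies n ≤ 2∣D∣ + 2: a
-- spanning tree of G[D] uses up 2(∣D∣ − 1) of the at most 3∣D∣ edge ends at D, and every
-- vertex outside D needs one of the others. In the equality case every vertex of D has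
-- degree 3 and every vertex outside D has exactly one neighbour in D.
--
-- As n ≥ k ≥ 6, no single vertex dominates G, so every class has a coalition partner. If
-- two coalitions V_a ∪ V_b and V_c ∪ V_d are disjoint, their two bounds together with
-- n ≥ ∣V_a∣ + ∣V_b∣ + ∣V_c∣ + ∣V_d∣ + (k − 4) force k = 6, equality in both bounds, and two
-- single-vertex classes V_e, V_f. If all six classes are single vertices, G is the prism or
-- K₃,₃ and H consists of the edges of G that dominate G: it is 3K₂ or M₆. Otherwise n ≥ 8,
-- up to symmetry V_e and V_f are partnered with V_a and V_c, and the equality cases force H
-- to be the double star with centres V_a and V_c.
-- If no two of the coalitions {V_i, partner of V_i} are disjoint, they share a class V_c.
-- A coalition avoiding V_c, together with one joining V_c to a fourth class, would make H
-- one of M₆, 3K₂, S₂,₂, none of which has a vertex adjacent to all others; so H is a star.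

module Submission where

open import Defs
open import Data.Bool using (Bool; true; false; not; _∧_; _∨_; if_then_else_)
import Data.Bool as Bool
open import Data.Bool.Properties using (not-¬; ∨-zeroʳ; T-∧)
open import Data.Empty using (⊥-elim)
open import Data.Fin using (Fin; zero; suc)
open import Data.Fin.Patterns using (0F; 1F; 2F; 3F; 4F; 5F)
open import Data.Fin.Permutation using (Permutation; permutation; _⟨$⟩ˡ_; inverseʳ; flip)
import Data.Fin.Permutation.Components as PC
open import Data.Fin.Properties using (_≟_; all?; any?; pigeonhole; injective⇒≤)
import Data.Fin.Properties as Fin
open import Data.List using (List; []; _∷_; tabulate)
open import Data.List.Membership.Propositional using () renaming (_∈_ to _∈ₗ_)
open import Data.List.Properties using (map-tabulate)
open import Data.List.Relation.Unary.All as All using (All; []; _∷_)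
import Data.Nat as ℕ
open import Data.Nat using (ℕ; zero; suc; _+_; _*_; _≤_; _<_; z≤n; s≤s; _<?_)
import Data.Nat.ListAction as List
open import Data.Nat.Properties hiding (_≟_)
open import Data.Nat.Tactic.RingSolver using (solve-∀)
open import Algebra.Properties.Semiring.Sum +-*-semiring
  using (sum; ∑-distrib-+; ∑-comm; sum-cong-≗; sum-replicate-zero; *-distribˡ-sum; sum-permute)
open import Data.Product using (∃; ∃₂; _×_; _,_; proj₁; proj₂)
open import Data.Product.Properties using (≡-dec)
open import Data.Sum using (_⊎_; inj₁; inj₂; [_,_]′)
import Data.Sum as Sum
open import Data.Unit using (tt)
open import Data.Vec using (Vec; []; _∷_; lookup)
open import Data.Vec.Membership.Propositional using (_∈_; _∉_)
open import Data.Vec.Relation.Unary.All using ([]; _∷_)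
open import Data.Vec.Relation.Unary.AllPairs using ([]; _∷_)
open import Data.Vec.Relation.Unary.Any as Any using (here; there)
open import Data.Vec.Relation.Unary.Any.Properties using (lookup-index)
open import Data.Vec.Relation.Unary.Unique.Propositional using (Unique)
open import Data.Vec.Relation.Unary.Unique.Propositional.Properties using (lookup-injective)
open import Function using (_∘_; id)
open import Function.Bundles using (_⇔_; mk⇔; Equivalence; Bijection)
open import Function.Construct.Composition using (_⇔-∘_)
open import Function.Construct.Symmetry using (⇔-sym)
open import Function.Properties.Inverse using (↔⇒⤖)
open import Level using (0ℓ)
open import Relation.Binary.Core using (Rel)
open import Relation.Binary.PropositionalEquality
open import Relation.Nullary using (¬_; Dec; yes; no; does)
open import Relation.Nullary.Decidable
  using (True; toWitness; dec-true; dec-false; decidable-stable; ¬?; _×-dec_; _→-dec_; _⊎-dec_; T?)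
open import Relation.Unary using (_∪_; _≐_)

-- Counting over Fin n

𝟙 : Bool → ℕ
𝟙 true  = 1
𝟙 false = 0

sum-mono-≤ : ∀ {n} {f g : Fin n → ℕ} → (∀ i → f i ≤ g i) → sum f ≤ sum g
sum-mono-≤ {zero}  _   = z≤n
sum-mono-≤ {suc n} f≤g = +-mono-≤ (f≤g zero) (sum-mono-≤ (f≤g ∘ suc))

sum-mono-≤-rigid : ∀ {n} {f g : Fin n → ℕ} → (∀ i → f i ≤ g i) → sum g ≤ sum f → ∀ i → f i ≡ g i
sum-mono-≤-rigid {suc n} {f} {g} f≤g ∑g≤∑f zero = ≤-antisym (f≤g zero) g₀≤f₀
  where
  g₀≤f₀ : g zero ≤ f zero
  g₀≤f₀ = +-cancelʳ-≤ (sum (g ∘ suc)) _ _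
    (≤-trans ∑g≤∑f (+-monoʳ-≤ (f zero) (sum-mono-≤ (f≤g ∘ suc))))
sum-mono-≤-rigid {suc n} {f} {g} f≤g ∑g≤∑f (suc i) = sum-mono-≤-rigid (f≤g ∘ suc) tail≤ i
  where
  tail≤ : sum (g ∘ suc) ≤ sum (f ∘ suc)
  tail≤ = +-cancelˡ-≤ (f zero) _ _ (≤-trans (+-monoˡ-≤ _ (f≤g zero)) ∑g≤∑f)

sum-<⇒∃< : ∀ {n} (f g : Fin n → ℕ) → sum f < sum g → ∃ λ i → f i < g i
sum-<⇒∃< f g ∑f<∑g with any? (λ i → f i <? g i)
... | yes witness = witness
... | no  none    = ⊥-elim (<⇒≱ ∑f<∑g (sum-mono-≤ (λ i → ≮⇒≥ (λ f<g → none (i , f<g)))))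

sum-ones : ∀ n → sum {n} (λ _ → 1) ≡ n
sum-ones zero    = refl
sum-ones (suc n) = cong suc (sum-ones n)

term≤sum : ∀ {n} (f : Fin n → ℕ) i → f i ≤ sum f
term≤sum f zero    = m≤m+n _ _
term≤sum f (suc i) = ≤-trans (term≤sum (f ∘ suc) i) (m≤n+m _ _)

two-terms≤sum : ∀ {n} (f : Fin n → ℕ) {i j} → i ≢ j → f i + f j ≤ sum f
two-terms≤sum f {zero}  {zero}  i≢j = ⊥-elim (i≢j refl)
two-terms≤sum f {zero}  {suc j} _   = +-monoʳ-≤ (f zero) (term≤sum (f ∘ suc) j)
two-terms≤sum f {suc i} {zero}  _   =
  subst (_≤ sum f) (+-comm (f zero) _) (+-monoʳ-≤ (f zero) (term≤sum (f ∘ suc) i))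
two-terms≤sum f {suc i} {suc j} i≢j =
  ≤-trans (two-terms≤sum (f ∘ suc) (i≢j ∘ cong suc)) (m≤n+m _ _)

sum₂ : ∀ {n} → (Fin n → Fin n → ℕ) → ℕ
sum₂ F = sum λ u → sum (F u)

sum₂-cong : ∀ {n} {F F′ : Fin n → Fin n → ℕ} → (∀ u v → F u v ≡ F′ u v) → sum₂ F ≡ sum₂ F′
sum₂-cong F≗F′ = sum-cong-≗ (λ u → sum-cong-≗ (F≗F′ u))

sum₂-mono-≤ : ∀ {n} {F F′ : Fin n → Fin n → ℕ} → (∀ u v → F u v ≤ F′ u v) → sum₂ F ≤ sum₂ F′
sum₂-mono-≤ F≤F′ = sum-mono-≤ (λ u → sum-mono-≤ (F≤F′ u))

sum₂-distrib-+ : ∀ {n} (F F′ : Fin n → Fin n → ℕ) →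
                 sum₂ (λ u v → F u v + F′ u v) ≡ sum₂ F + sum₂ F′
sum₂-distrib-+ F F′ =
  trans (sum-cong-≗ (λ u → ∑-distrib-+ (F u) (F′ u))) (∑-distrib-+ (sum ∘ F) (sum ∘ F′))

term≤sum₂ : ∀ {n} (F : Fin n → Fin n → ℕ) u v → F u v ≤ sum₂ F
term≤sum₂ F u v = ≤-trans (term≤sum (F u) v) (term≤sum (sum ∘ F) u)

-- Decidable vertex sets are Boolean predicates; ⟦ s ⟧ is the corresponding VSet.

∣_∣ : ∀ {n} → (Fin n → Bool) → ℕ
∣ s ∣ = sum (λ v → 𝟙 (s v))

⟦_⟧ : ∀ {n} → (Fin n → Bool) → VSet n
⟦ s ⟧ v = s v ≡ true

_⊆_ : ∀ {n} → (Fin n → Bool) → (Fin n → Bool) → Set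
s ⊆ t = ∀ v → s v ≡ true → t v ≡ true

⁅_⁆ : ∀ {n} → Fin n → Fin n → Bool
⁅ u ⁆ v = does (v ≟ u)

⁅⁆-refl : ∀ {n} (u : Fin n) → ⁅ u ⁆ u ≡ true
⁅⁆-refl u = dec-true (u ≟ u) refl

⁅⁆-sound : ∀ {n} {u v : Fin n} → ⁅ u ⁆ v ≡ true → v ≡ u
⁅⁆-sound {u = u} {v} eq with v ≟ u
... | yes v≡u = v≡u

∨-true : ∀ {a b} → a ∨ b ≡ true → a ≡ true ⊎ b ≡ true
∨-true {true}  _    = inj₁ refl
∨-true {false} b≡true = inj₂ b≡true

∧-true : ∀ {a b} → a ∧ b ≡ true → a ≡ true × b ≡ true
∧-true {true} b≡true = refl , b≡true

only-first : ∀ {a b} → 𝟙 a + 𝟙 b ≡ 1 → a ≡ true → b ≡ false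
only-first {true} {false} _ _ = refl

else-second : ∀ {a b} → 𝟙 a + 𝟙 b ≡ 1 → a ≡ false → b ≡ true
else-second {false} {true} _ _ = refl

else-first : ∀ {a b} → 𝟙 a + 𝟙 b ≡ 1 → b ≡ false → a ≡ true
else-first {true} {false} _ _ = refl

private
  𝟙-mono : ∀ {a b} → (a ≡ true → b ≡ true) → 𝟙 a ≤ 𝟙 b
  𝟙-mono {false} _   = z≤n
  𝟙-mono {true}  a⇒b rewrite a⇒b refl = ≤-refl

  𝟙-< : ∀ {a b} → 𝟙 a < 𝟙 b → a ≡ false × b ≡ true
  𝟙-< {false} {true} _ = refl , refl
  𝟙-< {true}  {true} (s≤s ())

  𝟙-≡ : ∀ {a b} → 𝟙 a ≡ 𝟙 b → a ≡ true → b ≡ true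
  𝟙-≡ {true} {true} _ _ = refl

⊆⇒∣∣≤ : ∀ {n} {s t : Fin n → Bool} → s ⊆ t → ∣ s ∣ ≤ ∣ t ∣
⊆⇒∣∣≤ s⊆t = sum-mono-≤ (λ v → 𝟙-mono (s⊆t v))

⊆∧∣∣≥⇒⊇ : ∀ {n} {s t : Fin n → Bool} → s ⊆ t → ∣ t ∣ ≤ ∣ s ∣ → t ⊆ s
⊆∧∣∣≥⇒⊇ s⊆t ∣t∣≤∣s∣ v = 𝟙-≡ (sym (sum-mono-≤-rigid (λ v → 𝟙-mono (s⊆t v)) ∣t∣≤∣s∣ v))

⊆∧∣∣≥⇒≗ : ∀ {n} {s t : Fin n → Bool} → s ⊆ t → ∣ t ∣ ≤ ∣ s ∣ → ∀ v → s v ≡ t v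
⊆∧∣∣≥⇒≗ {s = s} {t} s⊆t ∣t∣≤∣s∣ v with s v in sv | t v in tv
... | true  | true  = refl
... | false | false = refl
... | true  | false = trans (sym (s⊆t v sv)) tv
... | false | true  = trans (sym sv) (⊆∧∣∣≥⇒⊇ s⊆t ∣t∣≤∣s∣ v tv)

∣⁅⁆∣ : ∀ {n} (u : Fin n) → ∣ ⁅ u ⁆ ∣ ≡ 1
∣⁅⁆∣ {suc n} zero    = cong suc (sum-replicate-zero n)
∣⁅⁆∣ {suc n} (suc u) = ∣⁅⁆∣ u

∣∪∣ : ∀ {n} (s t : Fin n → Bool) → (∀ v → s v ∧ t v ≡ false) →
      ∣ (λ v → s v ∨ t v) ∣ ≡ ∣ s ∣ + ∣ t ∣
∣∪∣ s t disjoint =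
  trans (sum-cong-≗ (λ v → 𝟙-∨ (s v) (t v) (disjoint v))) (∑-distrib-+ (𝟙 ∘ s) (𝟙 ∘ t))
  where
  𝟙-∨ : ∀ a b → a ∧ b ≡ false → 𝟙 (a ∨ b) ≡ 𝟙 a + 𝟙 b
  𝟙-∨ true  false _ = refl
  𝟙-∨ false b     _ = refl

∣∣+∣∁∣ : ∀ {n} (s : Fin n → Bool) → ∣ s ∣ + ∣ not ∘ s ∣ ≡ n
∣∣+∣∁∣ {n} s =
  trans (sym (∑-distrib-+ (𝟙 ∘ s) (𝟙 ∘ not ∘ s))) (trans (sum-cong-≗ (𝟙+𝟙not ∘ s)) (sum-ones n))
  where
  𝟙+𝟙not : ∀ b → 𝟙 b + 𝟙 (not b) ≡ 1
  𝟙+𝟙not true  = refl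
  𝟙+𝟙not false = refl

∣∣≤1⇒≡ : ∀ {n} {s : Fin n → Bool} {u v} → ∣ s ∣ ≤ 1 → s u ≡ true → s v ≡ true → u ≡ v
∣∣≤1⇒≡ {u = u} {v} ∣s∣≤1 su sv with u ≟ v
... | yes u≡v = u≡v
... | no  u≢v = ⊥-elim (<⇒≱ (s≤s ∣s∣≤1)
        (≤-trans (≤-reflexive (sym (cong₂ (λ a b → 𝟙 a + 𝟙 b) su sv))) (two-terms≤sum _ u≢v)))

∣∣<⇒∃ : ∀ {n} (s t : Fin n → Bool) → ∣ s ∣ < ∣ t ∣ → ∃ λ v → s v ≡ false × t v ≡ true
∣∣<⇒∃ s t ∣s∣<∣t∣ with sum-<⇒∃< _ _ ∣s∣<∣t∣
... | v , 𝟙sv<𝟙tv = v , 𝟙-< 𝟙sv<𝟙tv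

nonempty : ∀ {n} (s : Fin n → Bool) → 0 < ∣ s ∣ → ∃ λ v → s v ≡ true
nonempty {n} s 0<∣s∣ with ∣∣<⇒∃ (λ _ → false) s (subst (_< ∣ s ∣) (sym (sum-replicate-zero n)) 0<∣s∣)
... | v , _ , sv = v , sv

two-members : ∀ {n} (s : Fin n → Bool) → 2 ≤ ∣ s ∣ → ∃₂ λ x y → s x ≡ true × s y ≡ true × x ≢ y
two-members s 2≤∣s∣ with nonempty s (≤-trans (s≤s z≤n) 2≤∣s∣)
... | x , sx with ∣∣<⇒∃ ⁅ x ⁆ s (subst (_< ∣ s ∣) (sym (∣⁅⁆∣ x)) 2≤∣s∣)
...   | y , y∉⁅x⁆ , sy = x , y , sx , sy , λ { refl → not-¬ (⁅⁆-refl x) y∉⁅x⁆ }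

-- Walks and the connected domination bound

module _ {n} (G : Graph n) where

  Adj-sym : ∀ {u v} → Adj G u v → Adj G v u
  Adj-sym {u} {v} uv = trans (E-sym G v u) uv

  Adj-irrefl : ∀ {u} → ¬ Adj G u u
  Adj-irrefl {u} uu with trans (sym uu) (E-irr G u)
  ... | ()

  deg≡∣E∣ : ∀ u → deg G u ≡ ∣ E G u ∣
  deg≡∣E∣ u = trans (cong List.sum (map-tabulate {n = n} id (λ v → if E G u v then 1 else 0)))
                    (list-sum (if-𝟙 ∘ E G u))
    where
    if-𝟙 : ∀ b → (if b then 1 else 0) ≡ 𝟙 b
    if-𝟙 true  = refl
    if-𝟙 false = refl
    list-sum : ∀ {m} {f g : Fin m → ℕ} → (∀ i → f i ≡ g i) → List.sum (tabulate f) ≡ sum g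
    list-sum {zero}  f≗g = refl
    list-sum {suc m} f≗g = cong₂ _+_ (f≗g zero) (list-sum (f≗g ∘ suc))

  walk-start : ∀ {S u v} → Walk G S u v → S u
  walk-start (here u∈S)     = u∈S
  walk-start (step u∈S _ _) = u∈S

  walk-map : ∀ {S T : VSet n} {u v} → (∀ {w} → S w → T w) → Walk G S u v → Walk G T u v
  walk-map S⊆T (here u∈S)         = here (S⊆T u∈S)
  walk-map S⊆T (step u∈S uw walk) = step (S⊆T u∈S) uw (walk-map S⊆T walk)

  walk-++ : ∀ {S u v w} → Walk G S u v → Walk G S v w → Walk G S u w
  walk-++ (here _)           walk′ = walk′
  walk-++ (step u∈S uv walk) walk′ = step u∈S uv (walk-++ walk walk′)

  walk-first-step : ∀ {S u v} → Walk G S u v → u ≢ v → ∃ λ w → S w × Adj G u w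
  walk-first-step (here _)         u≢u = ⊥-elim (u≢u refl)
  walk-first-step (step _ uw walk) _   = _ , walk-start walk , uw

  walk-exit : ∀ {S u v} (t : Fin n → Bool) → Walk G S u v → t u ≡ true → t v ≡ false →
              ∃₂ λ x y → t x ≡ true × t y ≡ false × S y × Adj G x y
  walk-exit t (here _) tu tv with trans (sym tu) tv
  ... | ()
  walk-exit t (step {v = w} _ uw walk) tu tv with t w in tw
  ... | true  = walk-exit t walk tw tv
  ... | false = _ , w , tu , tw , walk-start walk , uw

  -- A walk entering z must leave it through its only neighbour in S, where it came from.
  walk-avoiding : ∀ {S : VSet n} {x y} z →
    (∀ {u u′} → S u → S u′ → Adj G z u → Adj G z u′ → u ≡ u′) →
    Walk G S x y → x ≢ z → y ≢ z → Walk G (λ v → S v × v ≢ z) x y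
  walk-avoiding z unique (here x∈S) x≢z _ = here (x∈S , x≢z)
  walk-avoiding z unique (step {v = w} x∈S xw walk) x≢z y≢z with w ≟ z
  ... | no  w≢z = step (x∈S , x≢z) xw (walk-avoiding z unique walk w≢z y≢z)
  walk-avoiding z unique (step x∈S xw (here _)) x≢z y≢z | yes refl = ⊥-elim (y≢z refl)
  walk-avoiding z unique (step x∈S xz (step z∈S zw walk)) x≢z y≢z | yes refl
    with unique (walk-start walk) x∈S zw (Adj-sym xz)
  ... | refl = walk-avoiding z unique walk x≢z y≢z

  ConnDominating-resp : ∀ {S T : VSet n} → S ≐ T → ConnDominating G S → ConnDominating G T
  ConnDominating-resp (S⊆T , T⊆S) (dom , (u , u∈S) , conn) =
    (λ v v∉T → let w , w∈S , wv = dom v (v∉T ∘ S⊆T) in w , S⊆T w∈S , wv) ,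
    (u , S⊆T u∈S) ,
    (λ x y x∈T y∈T → walk-map S⊆T (conn x y (T⊆S x∈T) (T⊆S y∈T)))

  deg-in : (Fin n → Bool) → Fin n → ℕ
  deg-in s v = ∣ (λ u → s u ∧ E G u v) ∣

  unique-neighbour : ∀ {s v u u′} → deg-in s v ≡ 1 →
                     s u ≡ true → Adj G u v → s u′ ≡ true → Adj G u′ v → u ≡ u′
  unique-neighbour deg≡1 su uv su′ u′v =
    ∣∣≤1⇒≡ (≤-reflexive deg≡1) (cong₂ _∧_ su uv) (cong₂ _∧_ su′ u′v)

  some-neighbour : ∀ {s v} → deg-in s v ≡ 1 → ∃ λ u → s u ≡ true × Adj G u v
  some-neighbour {s} {v} deg≡1 with nonempty (λ u → s u ∧ E G u v) (≤-reflexive (sym deg≡1))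
  ... | u , su∧uv = u , ∧-true su∧uv

  Adj-of-deg-in-⁅⁆ : ∀ {w v} → 1 ≤ deg-in ⁅ w ⁆ v → Adj G w v
  Adj-of-deg-in-⁅⁆ {w} {v} 1≤ with nonempty (λ u → ⁅ w ⁆ u ∧ E G u v) 1≤
  ... | u , u∈⁅w⁆∧uv with ∧-true u∈⁅w⁆∧uv
  ...   | u≡w , uv = subst (λ x → Adj G x v) (⁅⁆-sound {u = w} {u} u≡w) uv

  deg≤cover : ∀ {v} (s₁ s₂ s₃ : Fin n → Bool) →
              (∀ u → Adj G v u → s₁ u ≡ true ⊎ s₂ u ≡ true ⊎ s₃ u ≡ true) →
              deg G v ≤ deg-in s₁ v + deg-in s₂ v + deg-in s₃ v
  deg≤cover {v} s₁ s₂ s₃ cover = begin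
    deg G v                                   ≡⟨ deg≡∣E∣ v ⟩
    ∣ E G v ∣                                 ≤⟨ sum-mono-≤ covered ⟩
    sum (λ u → T₁ u + T₂ u + T₃ u)            ≡⟨ ∑-distrib-+ (λ u → T₁ u + T₂ u) T₃ ⟩
    sum (λ u → T₁ u + T₂ u) + deg-in s₃ v     ≡⟨ cong (_+ deg-in s₃ v) (∑-distrib-+ T₁ T₂) ⟩
    deg-in s₁ v + deg-in s₂ v + deg-in s₃ v   ∎
    where
    open ≤-Reasoning
    T₁ T₂ T₃ : Fin n → ℕ
    T₁ u = 𝟙 (s₁ u ∧ E G u v)
    T₂ u = 𝟙 (s₂ u ∧ E G u v)
    T₃ u = 𝟙 (s₃ u ∧ E G u v)
    hit : ∀ {s u} → s u ≡ true → Adj G u v → 1 ≡ 𝟙 (s u ∧ E G u v)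
    hit su uv = sym (cong₂ (λ a b → 𝟙 (a ∧ b)) su uv)
    covered : ∀ u → 𝟙 (E G v u) ≤ T₁ u + T₂ u + T₃ u
    covered u with E G v u in vu
    ... | false = z≤n
    ... | true with cover u vu
    ...   | inj₁ s₁u        = ≤-trans (≤-reflexive (hit {s₁} s₁u (Adj-sym vu)))
                                      (≤-trans (m≤m+n _ (T₂ u)) (m≤m+n _ (T₃ u)))
    ...   | inj₂ (inj₁ s₂u) = ≤-trans (≤-reflexive (hit {s₂} s₂u (Adj-sym vu)))
                                      (≤-trans (m≤n+m _ (T₁ u)) (m≤m+n _ (T₃ u)))
    ...   | inj₂ (inj₂ s₃u) = ≤-trans (≤-reflexive (hit {s₃} s₃u (Adj-sym vu))) (m≤n+m _ (T₁ u + T₂ u))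

  -- twice the number of edges of G[s]
  adjacent-pairs : (Fin n → Bool) → ℕ
  adjacent-pairs s = sum₂ λ u v → 𝟙 (s u ∧ s v ∧ E G u v)

  adjacent-pairs-mono : ∀ {s t} → s ⊆ t → adjacent-pairs s ≤ adjacent-pairs t
  adjacent-pairs-mono {s} {t} s⊆t = sum₂-mono-≤ pair
    where
    pair : ∀ u v → 𝟙 (s u ∧ s v ∧ E G u v) ≤ 𝟙 (t u ∧ t v ∧ E G u v)
    pair u v with s u in su | s v in sv
    ... | false | _     = z≤n
    ... | true  | false = z≤n
    ... | true  | true  rewrite s⊆t u su | s⊆t v sv = ≤-refl

  private
    new-pairs : ∀ a b c d e → (b ≡ true → a ≡ false) → (d ≡ true → c ≡ false) →
                𝟙 (a ∧ c ∧ e) + 𝟙 (b ∧ c ∧ e) + 𝟙 (a ∧ d ∧ e) ≤ 𝟙 ((a ∨ b) ∧ (c ∨ d) ∧ e)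
    new-pairs true  true  _     _     _ b⇒¬a _ with b⇒¬a refl
    ... | ()
    new-pairs _     _     true  true  _ _ d⇒¬c with d⇒¬c refl
    ... | ()
    new-pairs false false _     _     _ _ _ = z≤n
    new-pairs false true  false _     _ _ _ = z≤n
    new-pairs false true  true  false e _ _ = ≤-reflexive (+-identityʳ (𝟙 e))
    new-pairs true  false false false _ _ _ = z≤n
    new-pairs true  false false true  e _ _ = ≤-refl
    new-pairs true  false true  false e _ _ = ≤-reflexive (trans (+-identityʳ _) (+-identityʳ (𝟙 e)))

  -- The new vertex y brings at least the pairs (y, x) and (x, y).
  adjacent-pairs-insert : ∀ {s x y} → s y ≡ false → s x ≡ true → Adj G x y →
                          adjacent-pairs s + 2 ≤ adjacent-pairs (λ v → s v ∨ ⁅ y ⁆ v)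
  adjacent-pairs-insert {s} {x} {y} sy sx xy = begin
    adjacent-pairs s + 2                   ≤⟨ +-monoʳ-≤ (adjacent-pairs s) (+-mono-≤ 1≤∑Y 1≤∑Z) ⟩
    adjacent-pairs s + (sum₂ Y + sum₂ Z)   ≡⟨ +-assoc (adjacent-pairs s) _ _ ⟨
    adjacent-pairs s + sum₂ Y + sum₂ Z     ≡⟨ cong (_+ sum₂ Z) (sum₂-distrib-+ X Y) ⟨
    sum₂ (λ u v → X u v + Y u v) + sum₂ Z  ≡⟨ sum₂-distrib-+ (λ u v → X u v + Y u v) Z ⟨
    sum₂ (λ u v → X u v + Y u v + Z u v)   ≤⟨ sum₂-mono-≤ (λ u v → new-pairs _ _ _ _ _ (y∉s u) (y∉s v)) ⟩
    adjacent-pairs (λ v → s v ∨ ⁅ y ⁆ v)   ∎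
    where
    open ≤-Reasoning
    X Y Z : Fin n → Fin n → ℕ
    X u v = 𝟙 (s u ∧ s v ∧ E G u v)
    Y u v = 𝟙 (⁅ y ⁆ u ∧ s v ∧ E G u v)
    Z u v = 𝟙 (s u ∧ ⁅ y ⁆ v ∧ E G u v)
    y∉s : ∀ u → ⁅ y ⁆ u ≡ true → s u ≡ false
    y∉s u u≡y = subst (λ w → s w ≡ false) (sym (⁅⁆-sound u≡y)) sy
    1≤∑Y : 1 ≤ sum₂ Y
    1≤∑Y = subst (_≤ sum₂ Y) (cong₂ (λ a b → 𝟙 (a ∧ b)) (⁅⁆-refl y) (cong₂ _∧_ sx (Adj-sym xy)))
                 (term≤sum₂ Y y x)
    1≤∑Z : 1 ≤ sum₂ Z
    1≤∑Z = subst (_≤ sum₂ Z) (cong₂ (λ a b → 𝟙 (a ∧ b)) sx (cong₂ _∧_ (⁅⁆-refl y) xy))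
                 (term≤sum₂ Z x y)

  module _ {s} (conn : ∀ u v → s u ≡ true → s v ≡ true → Walk G ⟦ s ⟧ u v) where

    private
      Grown : ℕ → Set
      Grown m = ∃ λ t → t ⊆ s × ∣ t ∣ ≡ m × 2 * m ≤ adjacent-pairs t + 2

      extend : ∀ {t x y j} → t ⊆ s → ∣ t ∣ ≡ suc j → 2 * suc j ≤ adjacent-pairs t + 2 →
               t x ≡ true → t y ≡ false → s y ≡ true → Adj G x y → Grown (suc (suc j))
      extend {t} {x} {y} {j} t⊆s ∣t∣≡ bound tx ty sy xy = t′ , t′⊆s , ∣t′∣≡ , bound′
        where
        t′ : Fin n → Bool
        t′ v = t v ∨ ⁅ y ⁆ v
        t′⊆s : t′ ⊆ s
        t′⊆s v v∈t′ with t v in tv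
        ... | true  = t⊆s v tv
        ... | false = subst (λ w → s w ≡ true) (sym (⁅⁆-sound v∈t′)) sy
        disjoint : ∀ v → t v ∧ ⁅ y ⁆ v ≡ false
        disjoint v with t v in tv | ⁅ y ⁆ v in yv
        ... | false | _     = refl
        ... | true  | false = refl
        ... | true  | true  = trans (sym tv) (subst (λ w → t w ≡ false) (sym (⁅⁆-sound yv)) ty)
        ∣t′∣≡ : ∣ t′ ∣ ≡ suc (suc j)
        ∣t′∣≡ = trans (∣∪∣ t ⁅ y ⁆ disjoint) (trans (cong₂ _+_ ∣t∣≡ (∣⁅⁆∣ y)) (+-comm (suc j) 1))
        bound′ : 2 * suc (suc j) ≤ adjacent-pairs t′ + 2
        bound′ = begin
          2 * suc (suc j)            ≡⟨ *-distribˡ-+ 2 1 (suc j) ⟩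
          2 + 2 * suc j              ≤⟨ +-monoʳ-≤ 2 bound ⟩
          2 + (adjacent-pairs t + 2) ≡⟨ +-comm 2 _ ⟩
          adjacent-pairs t + 2 + 2   ≤⟨ +-monoˡ-≤ 2 (adjacent-pairs-insert ty tx xy) ⟩
          adjacent-pairs t′ + 2      ∎
          where open ≤-Reasoning

      grow : ∀ j → suc j ≤ ∣ s ∣ → Grown (suc j)
      grow zero 1≤∣s∣ with nonempty s 1≤∣s∣
      ... | r , sr = ⁅ r ⁆ , (λ v v≡r → subst (λ w → s w ≡ true) (sym (⁅⁆-sound v≡r)) sr) ,
                     ∣⁅⁆∣ r , m≤n+m 2 _
      grow (suc j) j+2≤∣s∣ with grow j (≤-trans (n≤1+n _) j+2≤∣s∣)
      ... | t , t⊆s , ∣t∣≡ , bound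
        with ∣∣<⇒∃ t s (subst (_< ∣ s ∣) (sym ∣t∣≡) j+2≤∣s∣)
           | nonempty t (subst (0 <_) (sym ∣t∣≡) (s≤s z≤n))
      ...   | w , tw , sw | r , tr with walk-exit t (conn r w (t⊆s r tr) sw) tr tw
      ...     | x , y , tx , ty , sy , xy = extend t⊆s ∣t∣≡ bound tx ty sy xy

    spanning-tree-bound : 2 * ∣ s ∣ ≤ adjacent-pairs s + 2
    spanning-tree-bound with ∣ s ∣ in ∣s∣≡
    ... | zero  = z≤n
    ... | suc j with grow j (≤-reflexive (sym ∣s∣≡))
    ...   | t , t⊆s , _ , bound = ≤-trans bound (+-monoˡ-≤ 2 (adjacent-pairs-mono t⊆s))

  module _ (subcubic : ∀ u → deg G u ≤ 3) {s} (cds : ConnDominating G ⟦ s ⟧) where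

    private
      leaving : Fin n → Fin n → ℕ
      leaving u v = 𝟙 (s u ∧ not (s v) ∧ E G u v)

      out : ℕ
      out = sum₂ leaving

      degree-sum : ℕ
      degree-sum = sum₂ λ u v → 𝟙 (s u ∧ E G u v)

      c+⟨c+2⟩≡2c+2 : ∀ c → c + (c + 2) ≡ 2 * c + 2
      c+⟨c+2⟩≡2c+2 = solve-∀

      dominated : ∀ v → 𝟙 (not (s v)) ≤ sum (λ u → leaving u v)
      dominated v with s v in sv
      ... | true  = z≤n
      ... | false with proj₁ cds v (not-¬ sv)
      ...   | u , su , uv = subst (_≤ _) (cong₂ (λ a b → 𝟙 (a ∧ b)) su uv)
                                  (term≤sum (λ u → 𝟙 (s u ∧ E G u v)) u)

      ∣∁s∣≤out : ∣ not ∘ s ∣ ≤ out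
      ∣∁s∣≤out = ≤-trans (sum-mono-≤ dominated) (≤-reflexive (sym (∑-comm leaving)))

      degree-sum≡ : degree-sum ≡ adjacent-pairs s + out
      degree-sum≡ = trans (sum₂-cong (λ u v → split (s u) (s v) (E G u v)))
                          (sum₂-distrib-+ (λ u v → 𝟙 (s u ∧ s v ∧ E G u v)) leaving)
        where
        split : ∀ a b e → 𝟙 (a ∧ e) ≡ 𝟙 (a ∧ b ∧ e) + 𝟙 (a ∧ not b ∧ e)
        split false _     _ = refl
        split true  true  e = sym (+-identityʳ (𝟙 e))
        split true  false e = refl

      degree-row≤ : ∀ u → sum (λ v → 𝟙 (s u ∧ E G u v)) ≤ 3 * 𝟙 (s u)
      degree-row≤ u with s u
      ... | true  = ≤-trans (≤-reflexive (sym (deg≡∣E∣ u))) (subcubic u)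
      ... | false = ≤-reflexive (sum-replicate-zero n)

      degree-sum≤ : degree-sum ≤ 3 * ∣ s ∣
      degree-sum≤ = ≤-trans (sum-mono-≤ degree-row≤) (≤-reflexive (sym (*-distribˡ-sum 3 (𝟙 ∘ s))))

      out≤∣s∣+2 : out ≤ ∣ s ∣ + 2
      out≤∣s∣+2 = +-cancelʳ-≤ (2 * ∣ s ∣) out (∣ s ∣ + 2) (begin
        out + 2 * ∣ s ∣              ≤⟨ +-monoʳ-≤ out (spanning-tree-bound (proj₂ (proj₂ cds))) ⟩
        out + (adjacent-pairs s + 2) ≡⟨ o+⟨i+2⟩≡i+o+2 out (adjacent-pairs s) ⟩
        adjacent-pairs s + out + 2   ≡⟨ cong (_+ 2) degree-sum≡ ⟨
        degree-sum + 2               ≤⟨ +-monoˡ-≤ 2 degree-sum≤ ⟩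
        3 * ∣ s ∣ + 2                ≡⟨ 3c+2≡c+2+2c ∣ s ∣ ⟩
        ∣ s ∣ + 2 + 2 * ∣ s ∣        ∎)
        where
        open ≤-Reasoning
        o+⟨i+2⟩≡i+o+2 : ∀ o i → o + (i + 2) ≡ i + o + 2
        o+⟨i+2⟩≡i+o+2 = solve-∀
        3c+2≡c+2+2c : ∀ c → 3 * c + 2 ≡ c + 2 + 2 * c
        3c+2≡c+2+2c = solve-∀

    connected-domination-bound : n ≤ 2 * ∣ s ∣ + 2
    connected-domination-bound = begin
      n                      ≡⟨ ∣∣+∣∁∣ s ⟨
      ∣ s ∣ + ∣ not ∘ s ∣    ≤⟨ +-monoʳ-≤ ∣ s ∣ (≤-trans ∣∁s∣≤out out≤∣s∣+2) ⟩
      ∣ s ∣ + (∣ s ∣ + 2)    ≡⟨ c+⟨c+2⟩≡2c+2 ∣ s ∣ ⟩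
      2 * ∣ s ∣ + 2          ∎
      where open ≤-Reasoning

    module _ (tight : 2 * ∣ s ∣ + 2 ≤ n) where

      private
        ∣s∣+2≤∣∁s∣ : ∣ s ∣ + 2 ≤ ∣ not ∘ s ∣
        ∣s∣+2≤∣∁s∣ = +-cancelˡ-≤ ∣ s ∣ _ _ (begin
          ∣ s ∣ + (∣ s ∣ + 2)    ≡⟨ c+⟨c+2⟩≡2c+2 ∣ s ∣ ⟩
          2 * ∣ s ∣ + 2          ≤⟨ tight ⟩
          n                      ≡⟨ ∣∣+∣∁∣ s ⟨
          ∣ s ∣ + ∣ not ∘ s ∣    ∎)
          where open ≤-Reasoning

        3∣s∣≤degree-sum : 3 * ∣ s ∣ ≤ degree-sum
        3∣s∣≤degree-sum = +-cancelʳ-≤ 2 _ _ (begin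
          3 * ∣ s ∣ + 2               ≡⟨ 3c+2≡2c+⟨c+2⟩ ∣ s ∣ ⟩
          2 * ∣ s ∣ + (∣ s ∣ + 2)     ≤⟨ +-mono-≤ (spanning-tree-bound (proj₂ (proj₂ cds)))
                                                   (≤-trans ∣s∣+2≤∣∁s∣ ∣∁s∣≤out) ⟩
          adjacent-pairs s + 2 + out  ≡⟨ i+2+o≡i+o+2 (adjacent-pairs s) out ⟩
          adjacent-pairs s + out + 2  ≡⟨ cong (_+ 2) degree-sum≡ ⟨
          degree-sum + 2              ∎)
          where
          open ≤-Reasoning
          3c+2≡2c+⟨c+2⟩ : ∀ c → 3 * c + 2 ≡ 2 * c + (c + 2)
          3c+2≡2c+⟨c+2⟩ = solve-∀
          i+2+o≡i+o+2 : ∀ i o → i + 2 + o ≡ i + o + 2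
          i+2+o≡i+o+2 = solve-∀

      tight-unique-neighbour : ∀ v → s v ≡ false → deg-in s v ≡ 1
      tight-unique-neighbour v sv =
        sym (subst (λ b → 𝟙 (not b) ≡ sum (λ u → 𝟙 (s u ∧ not b ∧ E G u v))) sv
        (sum-mono-≤-rigid dominated (≤-trans (≤-reflexive (sym (∑-comm leaving)))
                                             (≤-trans out≤∣s∣+2 ∣s∣+2≤∣∁s∣)) v))

      tight-cubic : ∀ u → s u ≡ true → deg G u ≡ 3
      tight-cubic u su = trans (deg≡∣E∣ u) (subst (λ b → sum (λ v → 𝟙 (b ∧ E G u v)) ≡ 3 * 𝟙 b) su
        (sum-mono-≤-rigid degree-row≤
          (≤-trans (≤-reflexive (sym (*-distribˡ-sum 3 (𝟙 ∘ s)))) 3∣s∣≤degree-sum) u))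

-- Labellings and isomorphisms

module _ {m k} {H : Rel (Fin k) 0ℓ} {R : Rel (Fin m) 0ℓ} where

  ≅-of-labelling : (ℓ : Fin m → Fin k) → (∀ {p q} → ℓ p ≡ ℓ q → p ≡ q) → (∀ i → ∃ λ p → i ≡ ℓ p) →
                   (∀ p q → H (ℓ p) (ℓ q) ⇔ R p q) → H ≅ R
  ≅-of-labelling ℓ injective surjective table = ↔⇒⤖ (flip π) , λ i j →
    subst₂ (λ x y → H x y ⇔ R (π ⟨$⟩ˡ i) (π ⟨$⟩ˡ j)) (inverseʳ π) (inverseʳ π) (table _ _)
    where
    π : Permutation m k
    π = permutation ℓ (proj₁ ∘ surjective) (sym ∘ proj₂ ∘ surjective)
                    (λ p → injective (sym (proj₂ (surjective (ℓ p)))))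

  no-universal-vertex : (R? : ∀ p q → Dec (R p q)) →
    {_ : True (all? λ z → any? λ z′ → ¬? (z′ ≟ z) ×-dec ¬? (R? z′ z))} →
    H ≅ R → ∀ c → ¬ (∀ y → y ≢ c → H y c)
  no-universal-vertex R? {ok} (φ , preserves) c universal with toWitness ok (Bijection.to φ c)
  ... | z′ , z′≢φc , ¬R with Bijection.surjective φ z′
  ...   | y , φy≡z′ = ¬R (subst (λ t → R t (Bijection.to φ c)) (φy≡z′ refl)
                             (Equivalence.to (preserves y c) (universal y y≢c)))
    where
    y≢c : y ≢ c
    y≢c refl = z′≢φc (sym (φy≡z′ refl))

decide-⇔ : ∀ {m} {P Q : Rel (Fin m) 0ℓ} (P? : ∀ p q → Dec (P p q)) (Q? : ∀ p q → Dec (Q p q)) →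
           {_ : True (all? λ p → all? λ q → (P? p q →-dec Q? p q) ×-dec (Q? p q →-dec P? p q))} →
           ∀ p q → P p q ⇔ Q p q
decide-⇔ P? Q? {ok} p q = mk⇔ (proj₁ (toWitness ok p q)) (proj₂ (toWitness ok p q))

module _ {m k} {H : Rel (Fin k) 0ℓ} (H-sym : ∀ {i j} → H i j → H j i) (H-irrefl : ∀ {i} → ¬ H i i)
         (ℓ : Fin m → Fin k) (injective : ∀ {p q} → ℓ p ≡ ℓ q → p ≡ q)
         (surjective : ∀ i → ∃ λ p → i ≡ ℓ p) where

  Listed : List (Fin m × Fin m) → Fin m → Fin m → Set
  Listed ps p q = (p , q) ∈ₗ ps ⊎ (q , p) ∈ₗ ps

  private
    listed? : ∀ ps p q → Dec (Listed ps p q)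
    listed? ps p q = ((p , q) ∈? ps) ⊎-dec ((q , p) ∈? ps)
      where open import Data.List.Membership.DecPropositional (≡-dec _≟_ _≟_) using (_∈?_)

    H′ : Fin m × Fin m → Set
    H′ (p , q) = H (ℓ p) (ℓ q)

  -- R is given by lists of its edges and non-edges, whose completeness is checked by evaluation.
  ≅-of-edge-lists : ∀ {R : Rel (Fin m) 0ℓ} (R? : ∀ p q → Dec (R p q))
    (edges non-edges : List (Fin m × Fin m))
    {_ : True (all? λ p → all? λ q → (R? p q →-dec listed? edges p q)
                                     ×-dec (¬? (R? p q) →-dec (p ≟ q ⊎-dec listed? non-edges p q)))} →
    All H′ edges → All (¬_ ∘ H′) non-edges → H ≅ R
  ≅-of-edge-lists {R} R? edges non-edges {ok} in-H not-in-H =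
    ≅-of-labelling ℓ injective surjective λ p q → mk⇔ (to p q) (from p q (proj₁ (toWitness ok p q)))
    where
    from : ∀ p q → (R p q → Listed edges p q) → R p q → H′ (p , q)
    from p q listed r with listed r
    ... | inj₁ pq∈ = All.lookup in-H pq∈
    ... | inj₂ qp∈ = H-sym (All.lookup in-H qp∈)
    to : ∀ p q → H′ (p , q) → R p q
    to p q h with R? p q
    ... | yes r  = r
    ... | no  ¬r with proj₂ (toWitness ok p q) ¬r
    ...   | inj₁ refl       = ⊥-elim (H-irrefl h)
    ...   | inj₂ (inj₁ pq∈) = ⊥-elim (All.lookup not-in-H pq∈ h)
    ...   | inj₂ (inj₂ qp∈) = ⊥-elim (All.lookup not-in-H qp∈ (H-sym h))

module _ {m k} {f : Fin m → Fin k} (i j : Fin m) where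

  ∘transpose-injective : (∀ {p q} → f p ≡ f q → p ≡ q) →
                         ∀ {p q} → f (PC.transpose i j p) ≡ f (PC.transpose i j q) → p ≡ q
  ∘transpose-injective injective eq = trans (sym (PC.transpose-inverse j i))
    (trans (cong (PC.transpose j i) (injective eq)) (PC.transpose-inverse j i))

  ∘transpose-surjective : (∀ x → ∃ λ p → x ≡ f p) → ∀ x → ∃ λ p → x ≡ f (PC.transpose i j p)
  ∘transpose-surjective surjective x with surjective x
  ... | p , x≡fp = PC.transpose j i p , trans x≡fp (cong f (sym (PC.transpose-inverse i j)))

short-vec-misses : ∀ {m k} → m < k → (xs : Vec (Fin k) m) → ¬ (∀ x → x ∈ xs)
short-vec-misses m<k xs member with pigeonhole m<k (Any.index ∘ member)
... | i , j , i<j , same-index = Fin.<⇒≢ i<j (begin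
  i                                   ≡⟨ lookup-index (member i) ⟩
  lookup xs (Any.index (member i))    ≡⟨ cong (lookup xs) same-index ⟩
  lookup xs (Any.index (member j))    ≡⟨ lookup-index (member j) ⟨
  j                                   ∎)
  where open ≡-Reasoning

fresh : ∀ {m k} → m < k → (xs : Vec (Fin k) m) → ∃ λ x → x ∉ xs
fresh m<k xs with any? (λ x → ¬? (Any.any? (x ≟_) xs))
... | yes found = found
... | no  none  = ⊥-elim (short-vec-misses m<k xs
                            (λ x → decidable-stable (Any.any? (x ≟_) xs) (none ∘ (x ,_))))

Star⇔ : ∀ {k} (p q : Fin (suc k)) → Star (suc k) p q ⇔ (p ≢ q × (p ≡ zero ⊎ q ≡ zero))
Star⇔ zero    zero    = mk⇔ (λ ()) (λ (0≢0 , _) → ⊥-elim (0≢0 refl))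
Star⇔ zero    (suc q) = mk⇔ (λ _ → (λ ()) , inj₁ refl) (λ _ → tt)
Star⇔ (suc p) zero    = mk⇔ (λ _ → (λ ()) , inj₂ refl) (λ _ → tt)
Star⇔ (suc p) (suc q) = mk⇔ (λ star → ⊥-elim (proj₂ (Equivalence.to T-∧ star)))
                            (λ { (_ , inj₁ ()) ; (_ , inj₂ ()) })

≅-Star : ∀ {k} {R : Rel (Fin (suc k)) 0ℓ} c → (∀ i j → R i j ⇔ (i ≢ j × (i ≡ c ⊎ j ≡ c))) →
         R ≅ Star (suc k)
≅-Star {k} c centred =
  ≅-of-labelling t t-injective (∘transpose-surjective {f = id} 0F c (λ i → i , refl)) λ p q →
    ⇔-sym (Star⇔ p q) ⇔-∘ (relabel p q ⇔-∘ centred (t p) (t q))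
  where
  t : Fin (suc k) → Fin (suc k)
  t = PC.transpose 0F c
  t-injective : ∀ {p q} → t p ≡ t q → p ≡ q
  t-injective = ∘transpose-injective {f = id} 0F c id
  relabel : ∀ p q → (t p ≢ t q × (t p ≡ c ⊎ t q ≡ c)) ⇔ (p ≢ q × (p ≡ zero ⊎ q ≡ zero))
  relabel p q = mk⇔ (λ (tp≢tq , centre) → tp≢tq ∘ cong t , Sum.map t-injective t-injective centre)
                    (λ (p≢q , centre) → p≢q ∘ t-injective ,
                                        Sum.map (λ { refl → refl }) (λ { refl → refl }) centre)

module _ {k} (p : Fin k → Fin k) where

  Apart : Fin k → Fin k → Set
  Apart x y = x ≢ y × x ≢ p y × p x ≢ y × p x ≢ p y

  apart? : ∀ x y → Dec (Apart x y)
  apart? x y = ¬? (x ≟ y) ×-dec ¬? (x ≟ p y) ×-dec ¬? (p x ≟ y) ×-dec ¬? (p x ≟ p y)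

  common-vertex : (∀ x → p x ≢ x) → (∀ x y → ¬ Apart x y) → Fin k →
                  ∃ λ c → ∀ y → y ≢ c → p y ≡ c ⊎ p c ≡ y
  common-vertex no-loop meet a = centre (any? λ x → (¬? (x ≟ a) ×-dec ¬? (x ≟ b)) ×-dec (p x ≟ b))
    where
    b : Fin k
    b = p a

    -- an edge avoiding a and b would be apart from {a, b}
    toward : ∀ {y} → y ≢ a → y ≢ b → p y ≡ a ⊎ p y ≡ b
    toward {y} y≢a y≢b with p y ≟ a | p y ≟ b
    ... | yes py≡a | _        = inj₁ py≡a
    ... | no  _    | yes py≡b = inj₂ py≡b
    ... | no  py≢a | no  py≢b = ⊥-elim (meet y a (y≢a , y≢b , py≢a , py≢b))

    centre : Dec (∃ λ x → (x ≢ a × x ≢ b) × p x ≡ b) → ∃ λ c → ∀ y → y ≢ c → p y ≡ c ⊎ p c ≡ y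
    centre (yes (x , (x≢a , x≢b) , px≡b)) = b , at-b
      where
      at-b : ∀ y → y ≢ b → p y ≡ b ⊎ p b ≡ y
      at-b y y≢b with y ≟ a
      ... | yes refl = inj₁ refl
      ... | no  y≢a with toward y≢a y≢b
      ...   | inj₂ py≡b = inj₁ py≡b
      ...   | inj₁ py≡a = ⊥-elim (meet y x
              ( (λ { refl → no-loop a (trans (sym px≡b) py≡a) })
              , (λ y≡px → y≢b (trans y≡px px≡b))
              , (λ py≡x → x≢a (trans (sym py≡x) py≡a))
              , (λ py≡px → no-loop a (sym (trans (sym py≡a) (trans py≡px px≡b)))) ))
    centre (no none) = a , at-a
      where
      at-a : ∀ y → y ≢ a → p y ≡ a ⊎ p a ≡ y
      at-a y y≢a with y ≟ b
      ... | yes y≡b = inj₂ (sym y≡b)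
      ... | no  y≢b with toward y≢a y≢b
      ...   | inj₁ py≡a = inj₁ py≡a
      ...   | inj₂ py≡b = ⊥-elim (none (y , (y≢a , y≢b) , py≡b))

-- Cubic graphs on six vertices

-- the three neighbours of each vertex
Cubic₆ : Set
Cubic₆ = Fin 6 → Fin 6 × Fin 6 × Fin 6

triple : Fin 6 × Fin 6 × Fin 6 → Fin 6 → Bool
triple (x , y , z) q = ⁅ x ⁆ q ∨ ⁅ y ⁆ q ∨ ⁅ z ⁆ q

adjacency : Cubic₆ → Fin 6 → Fin 6 → Bool
adjacency N p = triple (N p)

-- triangles 0 2 4 and 1 3 5
prism : Cubic₆
prism 0F = 1F , 2F , 4F
prism 1F = 0F , 3F , 5F
prism 2F = 0F , 3F , 4F
prism 3F = 1F , 2F , 5F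
prism 4F = 0F , 2F , 5F
prism 5F = 1F , 3F , 4F

-- sides {0, 3, 5} and {1, 2, 4}
K₃₃ : Cubic₆
K₃₃ 0F = 1F , 2F , 4F
K₃₃ 1F = 0F , 3F , 5F
K₃₃ 2F = 0F , 3F , 5F
K₃₃ 3F = 1F , 2F , 4F
K₃₃ 4F = 0F , 3F , 5F
K₃₃ 5F = 1F , 2F , 4F

Contains : (Fin 6 → Bool) → Fin 6 × Fin 6 × Fin 6 → Set
Contains r (x , y , z) = r x ≡ true × r y ≡ true × r z ≡ true

triple⊆ : ∀ {r} t → Contains r t → triple t ⊆ r
triple⊆ {r} (x , y , z) (rx , ry , rz) q q∈t with ∨-true q∈t
... | inj₁ q≡x = subst (λ w → r w ≡ true) (sym (⁅⁆-sound {u = x} {q} q≡x)) rx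
... | inj₂ q∈yz with ∨-true q∈yz
...   | inj₁ q≡y = subst (λ w → r w ≡ true) (sym (⁅⁆-sound {u = y} {q} q≡y)) ry
...   | inj₂ q≡z = subst (λ w → r w ≡ true) (sym (⁅⁆-sound {u = z} {q} q≡z)) rz

row-of : ∀ (N : Cubic₆) {r} p → ∣ r ∣ ≡ 3 → ∣ adjacency N p ∣ ≡ 3 → Contains r (N p) →
         ∀ q → r q ≡ adjacency N p q
row-of N p ∣r∣≡3 ∣Np∣≡3 contains q =
  sym (⊆∧∣∣≥⇒≗ (triple⊆ (N p) contains) (≤-reflexive (trans ∣r∣≡3 (sym ∣Np∣≡3))) q)

private
  third-neighbour : ∀ {a b c d e f} → 𝟙 a + (𝟙 b + (𝟙 c + (𝟙 d + (𝟙 e + (𝟙 f + 0))))) ≡ 3 →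
                    a ≡ true → b ≡ false → e ≡ false → 𝟙 c + 𝟙 d ≡ 1 → f ≡ true
  third-neighbour {f = true} _ _ _ _ _ = refl
  third-neighbour {true} {false} {true}  {true}  {false} {false} _ _ _ _ ()
  third-neighbour {true} {false} {true}  {false} {false} {false} () _ _ _ _
  third-neighbour {true} {false} {false} {true}  {false} {false} () _ _ _ _
  third-neighbour {true} {false} {false} {false} {false} {false} _ _ _ _ ()

-- Vertices 0, …, 5 are named a, …, f.
module CubicSix (A : Fin 6 → Fin 6 → Bool) (A-sym : ∀ p q → A p q ≡ A q p)
    (A-irrefl : ∀ p → A p p ≡ false) (degree : ∀ p → ∣ A p ∣ ≡ 3)
    (one₀₁ : ∀ s → s ≢ 0F → s ≢ 1F → 𝟙 (A 0F s) + 𝟙 (A 1F s) ≡ 1)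
    (one₂₃ : ∀ s → s ≢ 2F → s ≢ 3F → 𝟙 (A 2F s) + 𝟙 (A 3F s) ≡ 1)
    (a~b : A 0F 1F ≡ true) (c~d : A 2F 3F ≡ true) (a~c : A 0F 2F ≡ true) (a~e : A 0F 4F ≡ true) where

  private
    ʳ : ∀ {p q b} → A p q ≡ b → A q p ≡ b
    ʳ {p} {q} eq = trans (A-sym q p) eq

    a≁d : A 0F 3F ≡ false
    a≁d = ʳ (only-first (one₂₃ 0F (λ ()) (λ ())) (ʳ a~c))

    b~d : A 1F 3F ≡ true
    b~d = else-second (one₀₁ 3F (λ ()) (λ ())) a≁d

    b≁e : A 1F 4F ≡ false
    b≁e = only-first (one₀₁ 4F (λ ()) (λ ())) a~e

    row₀ : ∀ q → A 0F q ≡ adjacency prism 0F q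
    row₀ = row-of prism 0F (degree 0F) refl (a~b , a~c , a~e)

    b~f : A 1F 5F ≡ true
    b~f = else-second (one₀₁ 5F (λ ()) (λ ())) (row₀ 5F)

    row₁ : ∀ q → A 1F q ≡ adjacency prism 1F q
    row₁ = row-of prism 1F (degree 1F) refl (ʳ a~b , b~d , b~f)

    e~f : A 4F 5F ≡ true
    e~f = third-neighbour {A 4F 0F} {A 4F 1F} {A 4F 2F} {A 4F 3F} {A 4F 4F} {A 4F 5F}
            (degree 4F) (ʳ a~e) (ʳ b≁e) (A-irrefl 4F)
            (trans (cong₂ (λ x y → 𝟙 x + 𝟙 y) (A-sym 4F 2F) (A-sym 4F 3F)) (one₂₃ 4F (λ ()) (λ ())))

    prism-rows : A 2F 4F ≡ true → ∀ p q → A p q ≡ adjacency prism p q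
    prism-rows c~e = rows
      where
      row₂ : ∀ q → A 2F q ≡ adjacency prism 2F q
      row₂ = row-of prism 2F (degree 2F) refl (ʳ a~c , c~d , c~e)
      d~f : A 3F 5F ≡ true
      d~f = else-second (one₂₃ 5F (λ ()) (λ ())) (row₂ 5F)
      rows : ∀ p q → A p q ≡ adjacency prism p q
      rows 0F = row₀
      rows 1F = row₁
      rows 2F = row₂
      rows 3F = row-of prism 3F (degree 3F) refl (ʳ b~d , ʳ c~d , d~f)
      rows 4F = row-of prism 4F (degree 4F) refl (ʳ a~e , ʳ c~e , e~f)
      rows 5F = row-of prism 5F (degree 5F) refl (ʳ b~f , ʳ d~f , ʳ e~f)

    K₃₃-rows : A 2F 4F ≡ false → ∀ p q → A p q ≡ adjacency K₃₃ p q
    K₃₃-rows c≁e = rows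
      where
      d~e : A 3F 4F ≡ true
      d~e = else-second (one₂₃ 4F (λ ()) (λ ())) c≁e
      row₃ : ∀ q → A 3F q ≡ adjacency K₃₃ 3F q
      row₃ = row-of K₃₃ 3F (degree 3F) refl (ʳ b~d , ʳ c~d , d~e)
      c~f : A 2F 5F ≡ true
      c~f = else-first (one₂₃ 5F (λ ()) (λ ())) (row₃ 5F)
      rows : ∀ p q → A p q ≡ adjacency K₃₃ p q
      rows 0F = row₀
      rows 1F = row₁
      rows 2F = row-of K₃₃ 2F (degree 2F) refl (ʳ a~c , c~d , c~f)
      rows 3F = row₃
      rows 4F = row-of K₃₃ 4F (degree 4F) refl (ʳ a~e , ʳ d~e , e~f)
      rows 5F = row-of K₃₃ 5F (degree 5F) refl (ʳ b~f , ʳ c~f , ʳ e~f)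

  prism-or-K₃₃ : (∀ p q → A p q ≡ adjacency prism p q) ⊎ (∀ p q → A p q ≡ adjacency K₃₃ p q)
  prism-or-K₃₃ with A 2F 4F in c~e?
  ... | true  = inj₁ (prism-rows c~e?)
  ... | false = inj₂ (K₃₃-rows c~e?)

DominatingEdge : (Fin 6 → Fin 6 → Bool) → Fin 6 → Fin 6 → Set
DominatingEdge A p q = p ≢ q × A p q ≡ true × (∀ s → s ≢ p → s ≢ q → A s p ∨ A s q ≡ true)

dominating-edge? : ∀ A p q → Dec (DominatingEdge A p q)
dominating-edge? A p q = ¬? (p ≟ q) ×-dec (A p q Bool.≟ true) ×-dec
  all? (λ s → ¬? (s ≟ p) →-dec ¬? (s ≟ q) →-dec (A s p ∨ A s q Bool.≟ true))

DominatingEdge-resp : ∀ {A B} → (∀ p q → A p q ≡ B p q) →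
                      ∀ p q → DominatingEdge A p q ⇔ DominatingEdge B p q
DominatingEdge-resp {A} {B} A≗B p q = mk⇔ (transport A≗B) (transport (λ p q → sym (A≗B p q)))
  where
  transport : ∀ {A B} → (∀ p q → A p q ≡ B p q) → DominatingEdge A p q → DominatingEdge B p q
  transport A≗B (p≢q , pq , dom) =
    p≢q , trans (sym (A≗B p q)) pq ,
    λ s s≢p s≢q → trans (sym (cong₂ _∨_ (A≗B s p) (A≗B s q))) (dom s s≢p s≢q)

prism-3K₂ : ∀ p q → DominatingEdge (adjacency prism) p q ⇔ ThreeK2 p q
prism-3K₂ = decide-⇔ {Q = ThreeK2} (dominating-edge? (adjacency prism)) (λ p q → T? _)

-- maps the sides {0, 2, 4}, {1, 3, 5} of M6 to those of K₃₃
swap₂₃₄₅ : Fin 6 → Fin 6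
swap₂₃₄₅ = PC.transpose 2F 3F ∘ PC.transpose 4F 5F

K₃₃-M₆ : ∀ p q → DominatingEdge (adjacency K₃₃) (swap₂₃₄₅ p) (swap₂₃₄₅ q) ⇔ M6 p q
K₃₃-M₆ = decide-⇔ {Q = M6} (λ p q → dominating-edge? (adjacency K₃₃) (swap₂₃₄₅ p) (swap₂₃₄₅ q))
                           (λ p q → T? _)

two-tight-bounds : ∀ {n x y r} → n ≡ x + y + r → 2 ≤ r → n ≤ 2 * x + 2 → n ≤ 2 * y + 2 →
                   2 * x + 2 ≤ n × 2 * y + 2 ≤ n × r ≤ 2
two-tight-bounds {n} {x} {y} {r} refl 2≤r n≤2x+2 n≤2y+2 =
  +-cancelʳ-≤ (2 * y + 2) _ _ (≤-trans both≤2n (+-monoʳ-≤ n n≤2y+2)) ,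
  +-cancelˡ-≤ (2 * x + 2) _ _ (≤-trans both≤2n (+-monoˡ-≤ n n≤2x+2)) ,
  *-cancelˡ-≤ 2 (+-cancelˡ-≤ (2 * (x + y)) _ _ (begin
    2 * (x + y) + 2 * r              ≡⟨ double x y r ⟨
    n + n                            ≤⟨ +-mono-≤ n≤2x+2 n≤2y+2 ⟩
    (2 * x + 2) + (2 * y + 2)        ≡⟨ sum-of-bounds x y ⟩
    2 * (x + y) + 2 * 2              ∎))
  where
  open ≤-Reasoning
  double : ∀ x y r → (x + y + r) + (x + y + r) ≡ 2 * (x + y) + 2 * r
  double = solve-∀
  sum-of-bounds : ∀ x y → (2 * x + 2) + (2 * y + 2) ≡ 2 * (x + y) + 2 * 2
  sum-of-bounds = solve-∀
  both≤2n : (2 * x + 2) + (2 * y + 2) ≤ n + n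
  both≤2n = begin
    (2 * x + 2) + (2 * y + 2)        ≡⟨ sum-of-bounds x y ⟩
    2 * (x + y) + 2 * 2              ≤⟨ +-monoʳ-≤ (2 * (x + y)) (*-monoʳ-≤ 2 2≤r) ⟩
    2 * (x + y) + 2 * r              ≡⟨ double x y r ⟨
    n + n                            ∎

-- Coalition partitions of subcubic graphs

module Coalitions {n k} (G : Graph n) (subcubic : ∀ u → deg G u ≤ 3) (part : Fin n → Fin k)
                  (ccp : IsCCPartition G part) where

  H : Fin k → Fin k → Set
  H = CCG G part

  cls : Fin k → Fin n → Bool
  cls i v = does (part v ≟ i)

  size : Fin k → ℕ
  size i = ∣ cls i ∣

  rep : Fin k → Fin n
  rep i = proj₁ (proj₁ ccp i)

  part-rep : ∀ i → part (rep i) ≡ i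
  part-rep i = proj₂ (proj₁ ccp i)

  cls-true : ∀ {i v} → part v ≡ i → cls i v ≡ true
  cls-true {i} {v} = dec-true (part v ≟ i)

  cls-false : ∀ {i v} → part v ≢ i → cls i v ≡ false
  cls-false {i} {v} = dec-false (part v ≟ i)

  cls-sound : ∀ {i v} → cls i v ≡ true → part v ≡ i
  cls-sound {i} {v} eq with part v ≟ i
  ... | yes pv≡i = pv≡i

  pair : Fin k → Fin k → Fin n → Bool
  pair i j v = cls i v ∨ cls j v

  pair-sound : ∀ {i j v} → pair i j v ≡ true → part v ≡ i ⊎ part v ≡ j
  pair-sound {i} {j} {v} eq with cls i v in civ
  ... | true  = inj₁ (cls-sound civ)
  ... | false = inj₂ (cls-sound eq)

  pair-left : ∀ {i j v} → part v ≡ i → pair i j v ≡ true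
  pair-left {i} {j} {v} pv rewrite cls-true {i} {v} pv = refl

  pair-right : ∀ {i j v} → part v ≡ j → pair i j v ≡ true
  pair-right {i} {j} {v} pv with cls i v
  ... | true  = refl
  ... | false = cls-true pv

  pair-outside : ∀ {i j v} → part v ≢ i → part v ≢ j → pair i j v ≡ false
  pair-outside {i} {j} {v} v∉i v∉j rewrite cls-false {i} {v} v∉i = cls-false v∉j

  ⟦pair⟧≐ : ∀ i j → (Class G part i ∪ Class G part j) ≐ ⟦ pair i j ⟧
  ⟦pair⟧≐ i j = (λ { (inj₁ pv) → pair-left pv ; (inj₂ pv) → pair-right pv }) , pair-sound

  size-pair : ∀ {i j} → i ≢ j → ∣ pair i j ∣ ≡ size i + size j
  size-pair {i} {j} i≢j = ∣∪∣ (cls i) (cls j) disjoint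
    where
    disjoint : ∀ v → cls i v ∧ cls j v ≡ false
    disjoint v with cls i v in civ | cls j v in cjv
    ... | false | _     = refl
    ... | true  | false = refl
    ... | true  | true  = ⊥-elim (i≢j (trans (sym (cls-sound civ)) (cls-sound cjv)))

  H-sym : ∀ {i j} → H i j → H j i
  H-sym (i≢j , ¬cdᵢ , ¬cdⱼ , cd) =
    i≢j ∘ sym , ¬cdⱼ , ¬cdᵢ , ConnDominating-resp G ((λ { (inj₁ x) → inj₂ x ; (inj₂ x) → inj₁ x })
                                                   , (λ { (inj₁ x) → inj₂ x ; (inj₂ x) → inj₁ x })) cd

  H-irrefl : ∀ {i} → ¬ H i i
  H-irrefl (i≢i , _) = i≢i refl

  coalition-cds : ∀ {i j} → H i j → ConnDominating G ⟦ pair i j ⟧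
  coalition-cds {i} {j} (_ , _ , _ , cd) = ConnDominating-resp G (⟦pair⟧≐ i j) cd

  coalition-bound : ∀ {i j} → H i j → n ≤ 2 * (size i + size j) + 2
  coalition-bound {i} {j} h = subst (λ m → n ≤ 2 * m + 2) (size-pair (proj₁ h))
                                    (connected-domination-bound G subcubic (coalition-cds h))

  module _ {i j} (h : H i j) (tight : 2 * (size i + size j) + 2 ≤ n) where

    private
      tight′ : 2 * ∣ pair i j ∣ + 2 ≤ n
      tight′ = subst (λ m → 2 * m + 2 ≤ n) (sym (size-pair (proj₁ h))) tight

    coalition-unique-neighbour : ∀ v → pair i j v ≡ false → deg-in G (pair i j) v ≡ 1
    coalition-unique-neighbour = tight-unique-neighbour G subcubic (coalition-cds h) tight′

    coalition-cubic : ∀ u → pair i j u ≡ true → deg G u ≡ 3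
    coalition-cubic = tight-cubic G subcubic (coalition-cds h) tight′

  singleton-rep : ∀ {i v} → size i ≡ 1 → part v ≡ i → v ≡ rep i
  singleton-rep {i} size≡1 pv = ∣∣≤1⇒≡ (≤-reflexive size≡1) (cls-true pv) (cls-true (part-rep i))

  1≤size : ∀ i → 1 ≤ size i
  1≤size i = subst (_≤ size i) (cong 𝟙 (cls-true (part-rep i))) (term≤sum (𝟙 ∘ cls i) (rep i))

  rep-injective : ∀ {i j} → rep i ≡ rep j → i ≡ j
  rep-injective {i} {j} eq = trans (sym (part-rep i)) (trans (cong part eq) (part-rep j))

  singleton-anchor : ∀ {i j} → H i j → size i ≡ 1 → ∃ λ w → part w ≡ j × Adj G (rep i) w
  singleton-anchor {i} {j} h single
    with walk-first-step G (proj₂ (proj₂ (coalition-cds h)) (rep i) (rep j)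
                             (pair-left (part-rep i)) (pair-right (part-rep j)))
                           (proj₁ h ∘ rep-injective)
  ... | w , w∈ij , i~w with pair-sound w∈ij
  ...   | inj₂ w∈j = w , w∈j , i~w
  ...   | inj₁ w∈i = ⊥-elim (Adj-irrefl G (subst (Adj G (rep i)) (singleton-rep single w∈i) i~w))

  only-rep⇒size≡1 : ∀ {i} → (∀ {v} → part v ≡ i → v ≡ rep i) → size i ≡ 1
  only-rep⇒size≡1 {i} only = ≤-antisym
    (≤-trans (⊆⇒∣∣≤ (λ v eq → dec-true (v ≟ rep i) (only (cls-sound eq)))) (≤-reflexive (∣⁅⁆∣ (rep i))))
    (1≤size i)

  -- Two singleton classes dominate at most six vertices.
  singletons-not-coalition : ∀ {i j} → 7 ≤ n → size i ≡ 1 → size j ≡ 1 → ¬ H i j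
  singletons-not-coalition 7≤n size-i size-j h
    with ≤-trans 7≤n (subst (λ m → n ≤ 2 * m + 2) (cong₂ _+_ size-i size-j) (coalition-bound h))
  ... | s≤s (s≤s (s≤s (s≤s (s≤s (s≤s ())))))

  -- A single vertex dominates at most four vertices.
  small-class-not-cds : ∀ {i} → 5 ≤ n → size i ≤ 1 → ¬ ConnDominating G (Class G part i)
  small-class-not-cds {i} 5≤n size≤1 cd = <⇒≱ 5≤n (≤-trans bound (+-monoˡ-≤ 2 (*-monoʳ-≤ 2 size≤1)))
    where
    bound : n ≤ 2 * size i + 2
    bound = connected-domination-bound G subcubic (ConnDominating-resp G (cls-true , cls-sound) cd)

  partner : 5 ≤ n → ∀ i → ∃ (H i)
  partner 5≤n i with proj₂ ccp i
  ... | inj₂ (j , coalition) = j , i≢j , coalition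
    where
    i≢j : i ≢ j
    i≢j refl = proj₁ coalition (ConnDominating-resp G ((λ { (inj₁ x) → x ; (inj₂ x) → x }) , inj₁)
                                                     (proj₂ (proj₂ coalition)))
  ... | inj₁ (cd , v , only-v) = ⊥-elim (small-class-not-cds 5≤n size≤1 cd)
    where
    size≤1 : size i ≤ 1
    size≤1 = ≤-trans (⊆⇒∣∣≤ (λ u eq → dec-true (u ≟ v) (Equivalence.to (only-v u) (cls-sound eq))))
                     (≤-reflexive (∣⁅⁆∣ v))

  -- The six classes, labelled by positions 0, …, 5, which are named a, …, f below.
  record Hexad : Set where
    field
      ℓ            : Fin 6 → Fin k
      ℓ-injective  : ∀ {p q} → ℓ p ≡ ℓ q → p ≡ q
      ℓ-surjective : ∀ i → ∃ λ p → i ≡ ℓ p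
      pair₁        : H (ℓ 0F) (ℓ 1F)
      pair₂        : H (ℓ 2F) (ℓ 3F)
      tight₁       : n ≡ 2 * (size (ℓ 0F) + size (ℓ 1F)) + 2
      tight₂       : n ≡ 2 * (size (ℓ 2F) + size (ℓ 3F)) + 2
      single₄      : size (ℓ 4F) ≡ 1
      single₅      : size (ℓ 5F) ≡ 1

  swap₀₁ : Hexad → Hexad
  swap₀₁ X = record
    { ℓ = ℓ ∘ PC.transpose 0F 1F
    ; ℓ-injective = ∘transpose-injective 0F 1F ℓ-injective
    ; ℓ-surjective = ∘transpose-surjective 0F 1F ℓ-surjective
    ; pair₁ = H-sym pair₁ ; pair₂ = pair₂
    ; tight₁ = trans tight₁ (cong (λ m → 2 * m + 2) (+-comm (size _) _)) ; tight₂ = tight₂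
    ; single₄ = single₄ ; single₅ = single₅ }
    where open Hexad X

  swap-pairs : Hexad → Hexad
  swap-pairs X = record
    { ℓ = ℓ ∘ PC.transpose 0F 2F ∘ PC.transpose 1F 3F
    ; ℓ-injective = ∘transpose-injective 1F 3F (∘transpose-injective 0F 2F ℓ-injective)
    ; ℓ-surjective = ∘transpose-surjective 1F 3F (∘transpose-surjective 0F 2F ℓ-surjective)
    ; pair₁ = pair₂ ; pair₂ = pair₁
    ; tight₁ = tight₂ ; tight₂ = tight₁ ; single₄ = single₄ ; single₅ = single₅ }
    where open Hexad X

  swap₂₃ : Hexad → Hexad
  swap₂₃ = swap-pairs ∘ swap₀₁ ∘ swap-pairs

  swap₄₅ : Hexad → Hexad
  swap₄₅ X = record
    { ℓ = ℓ ∘ PC.transpose 4F 5F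
    ; ℓ-injective = ∘transpose-injective 4F 5F ℓ-injective
    ; ℓ-surjective = ∘transpose-surjective 4F 5F ℓ-surjective
    ; pair₁ = pair₁ ; pair₂ = pair₂
    ; tight₁ = tight₁ ; tight₂ = tight₂ ; single₄ = single₅ ; single₅ = single₄ }
    where open Hexad X

  -- Two disjoint coalitions leave room for just two more classes, each a single vertex.
  module _ (6≤k : 6 ≤ k) {a b c d} (hab : H a b) (hcd : H c d)
           (a≢c : a ≢ c) (a≢d : a ≢ d) (b≢c : b ≢ c) (b≢d : b ≢ d) where

    private
      e-fresh : ∃ λ e → e ∉ (a ∷ b ∷ c ∷ d ∷ [])
      e-fresh = fresh (≤-trans (n≤1+n 5) 6≤k) (a ∷ b ∷ c ∷ d ∷ [])

      e : Fin k
      e = proj₁ e-fresh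

      e∉ : e ∉ (a ∷ b ∷ c ∷ d ∷ [])
      e∉ = proj₂ e-fresh

      f-fresh : ∃ λ f → f ∉ (a ∷ b ∷ c ∷ d ∷ e ∷ [])
      f-fresh = fresh 6≤k (a ∷ b ∷ c ∷ d ∷ e ∷ [])

      f : Fin k
      f = proj₁ f-fresh

      f∉ : f ∉ (a ∷ b ∷ c ∷ d ∷ e ∷ [])
      f∉ = proj₂ f-fresh

      labels : Vec (Fin k) 6
      labels = a ∷ b ∷ c ∷ d ∷ e ∷ f ∷ []

      labels-unique : Unique labels
      labels-unique =
        (proj₁ hab ∷ a≢c ∷ a≢d ∷ ≢e (e∉ ∘ here) ∷ ≢f (f∉ ∘ here) ∷ []) ∷
        (b≢c ∷ b≢d ∷ ≢e (e∉ ∘ there ∘ here) ∷ ≢f (f∉ ∘ there ∘ here) ∷ []) ∷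
        (proj₁ hcd ∷ ≢e (e∉ ∘ there ∘ there ∘ here) ∷ ≢f (f∉ ∘ there ∘ there ∘ here) ∷ []) ∷
        (≢e (e∉ ∘ there ∘ there ∘ there ∘ here) ∷ ≢f (f∉ ∘ there ∘ there ∘ there ∘ here) ∷ []) ∷
        (≢f (f∉ ∘ there ∘ there ∘ there ∘ there ∘ here) ∷ []) ∷ [] ∷ []
        where
        ≢e : ∀ {x} → e ≢ x → x ≢ e
        ≢e e≢x = e≢x ∘ sym
        ≢f : ∀ {x} → f ≢ x → x ≢ f
        ≢f f≢x = f≢x ∘ sym

      rest : Fin n → Bool
      rest v = not (pair a b v ∨ pair c d v)

      rest-outside : ∀ {i} → i ≢ a → i ≢ b → i ≢ c → i ≢ d → ∀ {v} → part v ≡ i → rest v ≡ true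
      rest-outside i≢a i≢b i≢c i≢d {v} pv
        rewrite pair-outside {a} {b} {v} (i≢a ∘ trans (sym pv)) (i≢b ∘ trans (sym pv))
              | pair-outside {c} {d} {v} (i≢c ∘ trans (sym pv)) (i≢d ∘ trans (sym pv)) = refl

      ∣rest∣≡ : n ≡ (size a + size b) + (size c + size d) + ∣ rest ∣
      ∣rest∣≡ = begin
        n                                                 ≡⟨ ∣∣+∣∁∣ both ⟨
        ∣ both ∣ + ∣ rest ∣                               ≡⟨ cong (_+ ∣ rest ∣) (∣∪∣ _ _ disjoint) ⟩
        ∣ pair a b ∣ + ∣ pair c d ∣ + ∣ rest ∣            ≡⟨ cong₂ (λ x y → x + y + ∣ rest ∣)
                                                                 (size-pair (proj₁ hab))
                                                                 (size-pair (proj₁ hcd)) ⟩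
        (size a + size b) + (size c + size d) + ∣ rest ∣  ∎
        where
        open ≡-Reasoning
        both : Fin n → Bool
        both v = pair a b v ∨ pair c d v
        disjoint : ∀ v → pair a b v ∧ pair c d v ≡ false
        disjoint v with pair a b v in abv | pair c d v in cdv
        ... | false | _     = refl
        ... | true  | false = refl
        ... | true  | true  with pair-sound abv | pair-sound cdv
        ...   | inj₁ pa | inj₁ pc = ⊥-elim (a≢c (trans (sym pa) pc))
        ...   | inj₁ pa | inj₂ pd = ⊥-elim (a≢d (trans (sym pa) pd))
        ...   | inj₂ pb | inj₁ pc = ⊥-elim (b≢c (trans (sym pb) pc))
        ...   | inj₂ pb | inj₂ pd = ⊥-elim (b≢d (trans (sym pb) pd))

      f≢e : f ≢ e
      f≢e = f∉ ∘ there ∘ there ∘ there ∘ there ∘ here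

      ve≢vf : rep e ≢ rep f
      ve≢vf = f≢e ∘ sym ∘ rep-injective

      e-rest : ∀ {v} → part v ≡ e → rest v ≡ true
      e-rest = rest-outside (e∉ ∘ here) (e∉ ∘ there ∘ here) (e∉ ∘ there ∘ there ∘ here)
                            (e∉ ∘ there ∘ there ∘ there ∘ here)

      f-rest : ∀ {v} → part v ≡ f → rest v ≡ true
      f-rest = rest-outside (f∉ ∘ here) (f∉ ∘ there ∘ here) (f∉ ∘ there ∘ there ∘ here)
                            (f∉ ∘ there ∘ there ∘ there ∘ here)

      reps : Fin n → Bool
      reps v = ⁅ rep e ⁆ v ∨ ⁅ rep f ⁆ v

      reps⊆rest : reps ⊆ rest
      reps⊆rest v eq with ⁅ rep e ⁆ v in ev
      ... | true  = subst (λ w → rest w ≡ true) (sym (⁅⁆-sound {u = rep e} ev)) (e-rest (part-rep e))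
      ... | false = subst (λ w → rest w ≡ true) (sym (⁅⁆-sound {u = rep f} eq)) (f-rest (part-rep f))

      ∣reps∣≡2 : ∣ reps ∣ ≡ 2
      ∣reps∣≡2 = trans (∣∪∣ ⁅ rep e ⁆ ⁅ rep f ⁆ disjoint) (cong₂ _+_ (∣⁅⁆∣ (rep e)) (∣⁅⁆∣ (rep f)))
        where
        disjoint : ∀ v → ⁅ rep e ⁆ v ∧ ⁅ rep f ⁆ v ≡ false
        disjoint v with ⁅ rep e ⁆ v in ev | ⁅ rep f ⁆ v in fv
        ... | false | _     = refl
        ... | true  | false = refl
        ... | true  | true  =
          ⊥-elim (ve≢vf (trans (sym (⁅⁆-sound {u = rep e} {v} ev)) (⁅⁆-sound {u = rep f} {v} fv)))

      bounds : 2 * (size a + size b) + 2 ≤ n × 2 * (size c + size d) + 2 ≤ n × ∣ rest ∣ ≤ 2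
      bounds = two-tight-bounds {x = size a + size b} {y = size c + size d} ∣rest∣≡
                 (subst (_≤ ∣ rest ∣) ∣reps∣≡2 (⊆⇒∣∣≤ reps⊆rest))
                 (coalition-bound hab) (coalition-bound hcd)

      rest⊆reps : rest ⊆ reps
      rest⊆reps = ⊆∧∣∣≥⇒⊇ reps⊆rest (subst (∣ rest ∣ ≤_) (sym ∣reps∣≡2) (proj₂ (proj₂ bounds)))

      rest-is-e-or-f : ∀ {v} → rest v ≡ true → v ≡ rep e ⊎ v ≡ rep f
      rest-is-e-or-f {v} restv =
        Sum.map (⁅⁆-sound {u = rep e}) (⁅⁆-sound {u = rep f}) (∨-true (rest⊆reps v restv))

      covered : ∀ i → i ∈ labels
      covered i with i ≟ a | i ≟ b | i ≟ c | i ≟ d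
      ... | yes i≡a | _       | _       | _       = here i≡a
      ... | no _    | yes i≡b | _       | _       = there (here i≡b)
      ... | no _    | no _    | yes i≡c | _       = there (there (here i≡c))
      ... | no _    | no _    | no _    | yes i≡d = there (there (there (here i≡d)))
      ... | no i≢a  | no i≢b  | no i≢c  | no i≢d
        with rest-is-e-or-f (rest-outside i≢a i≢b i≢c i≢d (part-rep i))
      ...   | inj₁ is-e = there (there (there (there (here (rep-injective is-e)))))
      ...   | inj₂ is-f = there (there (there (there (there (here (rep-injective is-f))))))

      e-single : size e ≡ 1
      e-single = only-rep⇒size≡1 (λ pv → only-e pv (rest-is-e-or-f (e-rest pv)))
        where
        only-e : ∀ {v} → part v ≡ e → v ≡ rep e ⊎ v ≡ rep f → v ≡ rep e
        only-e _  (inj₁ v≡ve) = v≡ve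
        only-e pv (inj₂ refl) = ⊥-elim (f≢e (trans (sym (part-rep f)) pv))

      f-single : size f ≡ 1
      f-single = only-rep⇒size≡1 (λ pv → only-f pv (rest-is-e-or-f (f-rest pv)))
        where
        only-f : ∀ {v} → part v ≡ f → v ≡ rep e ⊎ v ≡ rep f → v ≡ rep f
        only-f _  (inj₂ v≡vf) = v≡vf
        only-f pv (inj₁ refl) = ⊥-elim (f≢e (trans (sym pv) (part-rep e)))

    hexad : Hexad
    hexad = record
      { ℓ            = lookup labels
      ; ℓ-injective  = lookup-injective labels-unique _ _
      ; ℓ-surjective = λ i → Any.index (covered i) , lookup-index (covered i)
      ; pair₁        = hab
      ; pair₂        = hcd
      ; tight₁       = ≤-antisym (coalition-bound hab) (proj₁ bounds)
      ; tight₂       = ≤-antisym (coalition-bound hcd) (proj₁ (proj₂ bounds))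
      ; single₄      = e-single
      ; single₅      = f-single
      }

  module Positions (X : Hexad) where
    open Hexad X public

    ℓ-distinct : ∀ {p q} → p ≢ q → ℓ p ≢ ℓ q
    ℓ-distinct p≢q = p≢q ∘ ℓ-injective

    outside-pair : ∀ {v p q r} → part v ≡ ℓ p → p ≢ q → p ≢ r → pair (ℓ q) (ℓ r) v ≡ false
    outside-pair v∈p p≢q p≢r = pair-outside (p≢q ∘ ℓ-injective ∘ trans (sym v∈p))
                                            (p≢r ∘ ℓ-injective ∘ trans (sym v∈p))

    rep-outside : ∀ {p q r} → p ≢ q → p ≢ r → pair (ℓ q) (ℓ r) (rep (ℓ p)) ≡ false
    rep-outside {p} = outside-pair (part-rep (ℓ p))

    D₁ D₂ : Fin n → Bool
    D₁ = pair (ℓ 0F) (ℓ 1F)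
    D₂ = pair (ℓ 2F) (ℓ 3F)

    D₁-unique-neighbour : ∀ v → D₁ v ≡ false → deg-in G D₁ v ≡ 1
    D₁-unique-neighbour = coalition-unique-neighbour pair₁ (≤-reflexive (sym tight₁))

    D₂-unique-neighbour : ∀ v → D₂ v ≡ false → deg-in G D₂ v ≡ 1
    D₂-unique-neighbour = coalition-unique-neighbour pair₂ (≤-reflexive (sym tight₂))

    D₁-cubic : ∀ u → D₁ u ≡ true → deg G u ≡ 3
    D₁-cubic = coalition-cubic pair₁ (≤-reflexive (sym tight₁))

    partner-position : 5 ≤ n → ∀ p → ∃ λ q → H (ℓ p) (ℓ q)
    partner-position 5≤n p with partner 5≤n (ℓ p)
    ... | j , h with ℓ-surjective j
    ...   | q , j≡ℓq = q , subst (H (ℓ p)) j≡ℓq h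

  module Centre (X : Hexad) (e~a : H (Hexad.ℓ X 4F) (Hexad.ℓ X 0F)) where
    open Positions X

    private
      vb ve vf : Fin n
      vb = rep (ℓ 1F)
      ve = rep (ℓ 4F)
      vf = rep (ℓ 5F)

      e+a≡a+1 : 2 * (size (ℓ 4F) + size (ℓ 0F)) + 2 ≡ 2 * (size (ℓ 0F) + 1) + 2
      e+a≡a+1 = cong (λ m → 2 * m + 2) (trans (cong (_+ size (ℓ 0F)) single₄) (+-comm 1 (size (ℓ 0F))))

    b-single : size (ℓ 1F) ≡ 1
    b-single = ≤-antisym size-b≤1 (1≤size (ℓ 1F))
      where
      size-b≤1 : size (ℓ 1F) ≤ 1
      size-b≤1 = +-cancelˡ-≤ (size (ℓ 0F)) _ _ (*-cancelˡ-≤ 2 (+-cancelʳ-≤ 2 _ _ (begin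
        2 * (size (ℓ 0F) + size (ℓ 1F)) + 2  ≡⟨ tight₁ ⟨
        n                                    ≤⟨ coalition-bound e~a ⟩
        2 * (size (ℓ 4F) + size (ℓ 0F)) + 2  ≡⟨ e+a≡a+1 ⟩
        2 * (size (ℓ 0F) + 1) + 2            ∎)))
        where open ≤-Reasoning

    ea-tight : 2 * (size (ℓ 4F) + size (ℓ 0F)) + 2 ≤ n
    ea-tight = ≤-reflexive (trans e+a≡a+1
      (trans (cong (λ m → 2 * (size (ℓ 0F) + m) + 2) (sym b-single)) (sym tight₁)))

    e-anchor : ∃ λ w → part w ≡ ℓ 0F × Adj G ve w
    e-anchor = singleton-anchor e~a single₄

    -- The unique neighbour of V_e in V_a ∪ V_b lies in V_a.
    b≁e : ¬ Adj G vb ve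
    b≁e b~e with e-anchor
    ... | w , w∈a , e~w = ℓ-distinct (λ ()) (trans (sym (part-rep (ℓ 1F))) (trans (cong part vb≡w) w∈a))
      where
      vb≡w : vb ≡ w
      vb≡w = unique-neighbour G (D₁-unique-neighbour ve (rep-outside (λ ()) (λ ())))
               (pair-right (part-rep (ℓ 1F))) b~e (pair-left w∈a) (Adj-sym G e~w)

    b-anchor-unique : ∀ {u u′} → part u ≡ ℓ 0F → part u′ ≡ ℓ 0F → Adj G u vb → Adj G u′ vb → u ≡ u′
    b-anchor-unique u∈a u′∈a u~b u′~b =
      unique-neighbour G (coalition-unique-neighbour e~a ea-tight vb (rep-outside (λ ()) (λ ())))
                       (pair-right u∈a) u~b (pair-right u′∈a) u′~b

    private
      cover : ∀ u → Adj G vb u → pair (ℓ 4F) (ℓ 0F) u ≡ true ⊎ D₂ u ≡ true ⊎ ⁅ vf ⁆ u ≡ true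
      cover u b~u with ℓ-surjective (part u)
      ... | 0F , u∈a = inj₁ (pair-right u∈a)
      ... | 1F , u∈b = ⊥-elim (Adj-irrefl G (subst (Adj G vb) (singleton-rep b-single u∈b) b~u))
      ... | 2F , u∈c = inj₂ (inj₁ (pair-left u∈c))
      ... | 3F , u∈d = inj₂ (inj₁ (pair-right u∈d))
      ... | 4F , u∈e = inj₁ (pair-left u∈e)
      ... | 5F , u∈f = inj₂ (inj₂ (dec-true (u ≟ vf) (singleton-rep single₅ u∈f)))
      ea-once : deg-in G (pair (ℓ 4F) (ℓ 0F)) vb ≡ 1
      ea-once = coalition-unique-neighbour e~a ea-tight vb (rep-outside {1F} {4F} {0F} (λ ()) (λ ()))

      d-once : deg-in G D₂ vb ≡ 1
      d-once = D₂-unique-neighbour vb (rep-outside {1F} {2F} {3F} (λ ()) (λ ()))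

      b-cubic : deg G vb ≡ 3
      b-cubic = D₁-cubic vb (pair-right (part-rep (ℓ 1F)))

      b-deg≤ : deg G vb ≤ deg-in G (pair (ℓ 4F) (ℓ 0F)) vb + deg-in G D₂ vb + deg-in G ⁅ vf ⁆ vb
      b-deg≤ = deg≤cover G (pair (ℓ 4F) (ℓ 0F)) D₂ ⁅ vf ⁆ cover

      1≤deg-in-f : 1 ≤ deg-in G ⁅ vf ⁆ vb
      1≤deg-in-f = +-cancelˡ-≤ 2 1 (deg-in G ⁅ vf ⁆ vb)
        (subst (_≤ 1 + 1 + deg-in G ⁅ vf ⁆ vb) b-cubic
          (≤-trans b-deg≤ (≤-reflexive (cong₂ (λ x y → x + y + deg-in G ⁅ vf ⁆ vb) ea-once d-once))))

    -- V_b has degree 3 but only one neighbour in V_e ∪ V_a and one in V_c ∪ V_d.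
    b~f : Adj G vb vf
    b~f = Adj-sym G (Adj-of-deg-in-⁅⁆ G {vf} {vb} 1≤deg-in-f)

    f≁a : ∀ {u} → part u ≡ ℓ 0F → ¬ Adj G u vf
    f≁a {u} u∈a u~f = ℓ-distinct (λ ()) (trans (sym u∈a) (trans (cong part u≡vb) (part-rep (ℓ 1F))))
      where
      u≡vb : u ≡ vb
      u≡vb = unique-neighbour G (D₁-unique-neighbour vf (rep-outside {5F} {0F} {1F} (λ ()) (λ ())))
               (pair-left u∈a) u~f (pair-right (part-rep (ℓ 1F))) b~f

  module Side (X : Hexad) (8≤n : 8 ≤ n)
              (e~a : H (Hexad.ℓ X 4F) (Hexad.ℓ X 0F))
              (f~c : H (Hexad.ℓ X 5F) (Hexad.ℓ X 2F)) where
    open Positions X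

    module L = Centre X e~a
    module L′ = Centre (swap-pairs (swap₄₅ X)) f~c

    ¬a~d : ¬ H (ℓ 0F) (ℓ 3F)
    ¬a~d a~d
      with proj₁ (coalition-cds a~d) (rep (ℓ 5F)) (not-¬ (rep-outside {5F} {0F} {3F} (λ ()) (λ ())))
    ... | u , u∈ad , u~f with pair-sound u∈ad
    ...   | inj₁ u∈a = L.f≁a u∈a u~f
    ...   | inj₂ u∈d = L′.b≁e (subst (λ w → Adj G w (rep (ℓ 5F))) (singleton-rep L′.b-single u∈d) u~f)

    ¬a~f : ¬ H (ℓ 0F) (ℓ 5F)
    ¬a~f a~f with singleton-anchor (H-sym a~f) single₅
    ... | w , w∈a , f~w = L.f≁a w∈a (Adj-sym G f~w)

    b-anchored : ∃ λ w → part w ≡ ℓ 0F × Adj G (rep (ℓ 1F)) w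
    b-anchored = singleton-anchor (H-sym pair₁) L.b-single

    a-connected : ∀ {x y} → part x ≡ ℓ 0F → part y ≡ ℓ 0F → Walk G (Class G part (ℓ 0F)) x y
    a-connected {x} {y} x∈a y∈a =
      walk-map G only-a (walk-avoiding G vb unique
        (proj₂ (proj₂ (coalition-cds pair₁)) x y (pair-left x∈a) (pair-left y∈a))
        (not-b x∈a) (not-b y∈a))
      where
      vb : Fin n
      vb = rep (ℓ 1F)
      not-b : ∀ {w} → part w ≡ ℓ 0F → w ≢ vb
      not-b w∈a refl = ℓ-distinct {1F} {0F} (λ ()) (trans (sym (part-rep (ℓ 1F))) w∈a)
      in-a : ∀ {u} → pair (ℓ 0F) (ℓ 1F) u ≡ true → Adj G vb u → part u ≡ ℓ 0F
      in-a u∈ab b~u with pair-sound u∈ab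
      ... | inj₁ u∈a = u∈a
      ... | inj₂ u∈b = ⊥-elim (Adj-irrefl G (subst (Adj G vb) (singleton-rep L.b-single u∈b) b~u))
      unique : ∀ {u u′} → pair (ℓ 0F) (ℓ 1F) u ≡ true → pair (ℓ 0F) (ℓ 1F) u′ ≡ true →
               Adj G vb u → Adj G vb u′ → u ≡ u′
      unique u∈ab u′∈ab b~u b~u′ =
        L.b-anchor-unique (in-a u∈ab b~u) (in-a u′∈ab b~u′) (Adj-sym G b~u) (Adj-sym G b~u′)
      only-a : ∀ {w} → pair (ℓ 0F) (ℓ 1F) w ≡ true × w ≢ vb → part w ≡ ℓ 0F
      only-a (w∈ab , w≢vb) with pair-sound w∈ab
      ... | inj₁ w∈a = w∈a
      ... | inj₂ w∈b = ⊥-elim (w≢vb (singleton-rep L.b-single w∈b))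

    2≤size-a : 2 ≤ size (ℓ 0F)
    2≤size-a = +-cancelʳ-≤ 1 2 (size (ℓ 0F)) (*-cancelˡ-≤ 2 (+-cancelʳ-≤ 2 6 _
      (≤-trans 8≤n (≤-reflexive (trans tight₁ (cong (λ m → 2 * (size (ℓ 0F) + m) + 2) L.b-single))))))

  module DoubleStar (X : Hexad) (8≤n : 8 ≤ n)
              (e~a : H (Hexad.ℓ X 4F) (Hexad.ℓ X 0F))
              (f~c : H (Hexad.ℓ X 5F) (Hexad.ℓ X 2F)) where
    open Positions X

    private
      module A = Side X 8≤n e~a f~c
      module C = Side (swap-pairs (swap₄₅ X)) 8≤n f~c e~a

      2≤size-c : 2 ≤ size (ℓ 2F)
      2≤size-c = C.2≤size-a

      c-two : ∃₂ λ w₁ w₂ → cls (ℓ 2F) w₁ ≡ true × cls (ℓ 2F) w₂ ≡ true × w₁ ≢ w₂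
      c-two = two-members (cls (ℓ 2F)) 2≤size-c

      c-anchor : ∀ {w} → part w ≡ ℓ 2F → ∃ λ u → D₁ u ≡ true × Adj G u w
      c-anchor {w} w∈c = some-neighbour G {D₁} {w}
        (D₁-unique-neighbour w (outside-pair {w} {2F} {0F} {1F} w∈c (λ ()) (λ ())))

      -- The D₁-neighbours of two vertices of V_c cannot both be the single vertex of V_b.
      choose : ∀ {w₁ w₂ u₁ u₂} → part w₁ ≡ ℓ 2F → part w₂ ≡ ℓ 2F → w₁ ≢ w₂ →
               D₁ u₁ ≡ true → Adj G u₁ w₁ → D₁ u₂ ≡ true → Adj G u₂ w₂ →
               ∃₂ λ u w → part u ≡ ℓ 0F × part w ≡ ℓ 2F × Adj G u w
      choose {w₁} {w₂} {u₁} {u₂} w₁∈c w₂∈c w₁≢w₂ u₁∈D₁ u₁~w₁ u₂∈D₁ u₂~w₂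
        with pair-sound {ℓ 0F} {ℓ 1F} {u₁} u₁∈D₁ | pair-sound {ℓ 0F} {ℓ 1F} {u₂} u₂∈D₁
      ... | inj₁ u₁∈a | _         = u₁ , w₁ , u₁∈a , w₁∈c , u₁~w₁
      ... | inj₂ _    | inj₁ u₂∈a = u₂ , w₂ , u₂∈a , w₂∈c , u₂~w₂
      ... | inj₂ u₁∈b | inj₂ u₂∈b = ⊥-elim (w₁≢w₂ (unique-neighbour G {D₂} {vb} {w₁} {w₂}
              (D₂-unique-neighbour vb (rep-outside {1F} {2F} {3F} (λ ()) (λ ())))
              (pair-left w₁∈c) (b-to u₁∈b u₁~w₁) (pair-left w₂∈c) (b-to u₂∈b u₂~w₂)))
        where
        vb : Fin n
        vb = rep (ℓ 1F)
        b-to : ∀ {u w} → part u ≡ ℓ 1F → Adj G u w → Adj G w vb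
        b-to u∈b u~w = Adj-sym G (subst (λ x → Adj G x _) (singleton-rep A.L.b-single u∈b) u~w)

      a-c-edge : ∃₂ λ u w → part u ≡ ℓ 0F × part w ≡ ℓ 2F × Adj G u w
      a-c-edge =
        let w₁ , w₂ , w₁∈c , w₂∈c , w₁≢w₂ = c-two
            u₁ , u₁∈D₁ , u₁~w₁ = c-anchor {w₁} (cls-sound {ℓ 2F} {w₁} w₁∈c)
            u₂ , u₂∈D₁ , u₂~w₂ = c-anchor {w₂} (cls-sound {ℓ 2F} {w₂} w₂∈c)
        in choose (cls-sound {ℓ 2F} {w₁} w₁∈c) (cls-sound {ℓ 2F} {w₂} w₂∈c) w₁≢w₂
                  u₁∈D₁ u₁~w₁ u₂∈D₁ u₂~w₂

      AC : VSet n
      AC = Class G part (ℓ 0F) ∪ Class G part (ℓ 2F)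

      anchored : ∀ {v x w} → v ≡ x → AC w → Adj G x w → ∃ λ u → AC u × Adj G u v
      anchored refl w∈ac x~w = _ , w∈ac , Adj-sym G x~w

      dominating : Dominating G AC
      dominating v v∉ac = dominate (ℓ-surjective (part v))
        where
        dominate : (∃ λ p → part v ≡ ℓ p) → ∃ λ u → AC u × Adj G u v
        dominate (0F , v∈a) = ⊥-elim (v∉ac (inj₁ v∈a))
        dominate (1F , v∈b) = let w , w∈a , b~w = A.b-anchored in
                              anchored (singleton-rep A.L.b-single v∈b) (inj₁ w∈a) b~w
        dominate (2F , v∈c) = ⊥-elim (v∉ac (inj₂ v∈c))
        dominate (3F , v∈d) = let w , w∈c , d~w = C.b-anchored in
                              anchored (singleton-rep C.L.b-single v∈d) (inj₂ w∈c) d~w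
        dominate (4F , v∈e) = let w , w∈a , e~w = A.L.e-anchor in
                              anchored (singleton-rep single₄ v∈e) (inj₁ w∈a) e~w
        dominate (5F , v∈f) = let w , w∈c , f~w = C.L.e-anchor in
                              anchored (singleton-rep single₅ v∈f) (inj₂ w∈c) f~w

      connected : ∀ x y → AC x → AC y → Walk G AC x y
      connected x y (inj₁ x∈a) (inj₁ y∈a) = walk-map G inj₁ (A.a-connected x∈a y∈a)
      connected x y (inj₂ x∈c) (inj₂ y∈c) = walk-map G inj₂ (C.a-connected x∈c y∈c)
      connected x y (inj₁ x∈a) (inj₂ y∈c) =
        let u , w , u∈a , w∈c , u~w = a-c-edge in
        walk-++ G (walk-map G inj₁ (A.a-connected x∈a u∈a))
                  (step (inj₁ u∈a) u~w (walk-map G inj₂ (C.a-connected w∈c y∈c)))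
      connected x y (inj₂ x∈c) (inj₁ y∈a) =
        let u , w , u∈a , w∈c , u~w = a-c-edge in
        walk-++ G (walk-map G inj₂ (C.a-connected x∈c w∈c))
                  (step (inj₂ w∈c) (Adj-sym G u~w) (walk-map G inj₁ (A.a-connected u∈a y∈a)))

    a~c : H (ℓ 0F) (ℓ 2F)
    a~c = (λ ()) ∘ ℓ-injective , proj₁ (proj₂ pair₁) , proj₁ (proj₂ pair₂) ,
          dominating , (rep (ℓ 0F) , inj₁ (part-rep (ℓ 0F))) , connected

    -- S22 has centres 0, 1 with leaves 2, 3 and 4, 5; here they are a, c with b, e and d, f.
    ≅S22 : H ≅ S22
    ≅S22 =
      ≅-of-edge-lists H-sym H-irrefl (ℓ ∘ PC.transpose 1F 2F ∘ PC.transpose 3F 4F)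
        (∘transpose-injective 3F 4F (∘transpose-injective 1F 2F ℓ-injective))
        (∘transpose-surjective 3F 4F (∘transpose-surjective 1F 2F ℓ-surjective))
        {S22} (λ p q → T? _)
        ((0F , 1F) ∷ (0F , 2F) ∷ (0F , 3F) ∷ (1F , 4F) ∷ (1F , 5F) ∷ [])
        ((0F , 4F) ∷ (0F , 5F) ∷ (1F , 2F) ∷ (1F , 3F) ∷ (2F , 3F) ∷
         (2F , 4F) ∷ (2F , 5F) ∷ (3F , 4F) ∷ (3F , 5F) ∷ (4F , 5F) ∷ [])
        (a~c ∷ pair₁ ∷ H-sym e~a ∷ pair₂ ∷ H-sym f~c ∷ [])
        (A.¬a~d ∷ A.¬a~f ∷ C.¬a~d ∷ C.¬a~f ∷
         apart A.L.b-single single₄ ∷ apart A.L.b-single C.L.b-single ∷ apart A.L.b-single single₅ ∷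
         apart single₄ C.L.b-single ∷ apart single₄ single₅ ∷ apart C.L.b-single single₅ ∷ [])
      where
      apart : ∀ {i j} → size i ≡ 1 → size j ≡ 1 → ¬ H i j
      apart = singletons-not-coalition (≤-trans (n≤1+n 7) 8≤n)

  module _ (8≤n : 8 ≤ n) where

    private
      7≤n : 7 ≤ n
      7≤n = ≤-trans (n≤1+n 7) 8≤n

      5≤n : 5 ≤ n
      5≤n = ≤-trans (m≤m+n 5 3) 8≤n

      with-e~a : (X : Hexad) → H (Hexad.ℓ X 4F) (Hexad.ℓ X 0F) → H ≅ S22
      with-e~a X e~a = f-partner (partner-position 5≤n 5F)
        where
        open Positions X
        f-partner : (∃ λ q → H (ℓ 5F) (ℓ q)) → H ≅ S22
        f-partner (0F , f~a) = let w , w∈a , f~w = singleton-anchor f~a single₅ in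
                               ⊥-elim (Centre.f≁a X e~a w∈a (Adj-sym G f~w))
        f-partner (1F , f~b) = ⊥-elim (singletons-not-coalition 7≤n single₅ (Centre.b-single X e~a) f~b)
        f-partner (2F , f~c) = DoubleStar.≅S22 X 8≤n e~a f~c
        f-partner (3F , f~d) = DoubleStar.≅S22 (swap₂₃ X) 8≤n e~a f~d
        f-partner (4F , f~e) = ⊥-elim (singletons-not-coalition 7≤n single₅ single₄ f~e)
        f-partner (5F , f~f) = ⊥-elim (H-irrefl f~f)

    hexad-double-star : Hexad → H ≅ S22
    hexad-double-star X = e-partner (partner-position 5≤n 4F)
      where
      open Positions X
      e-partner : (∃ λ q → H (ℓ 4F) (ℓ q)) → H ≅ S22
      e-partner (0F , e~a) = with-e~a X e~a
      e-partner (1F , e~b) = with-e~a (swap₀₁ X) e~b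
      e-partner (2F , e~c) = with-e~a (swap-pairs X) e~c
      e-partner (3F , e~d) = with-e~a (swap₀₁ (swap-pairs X)) e~d
      e-partner (4F , e~e) = ⊥-elim (H-irrefl e~e)
      e-partner (5F , e~f) = ⊥-elim (singletons-not-coalition 7≤n single₄ single₅ e~f)

  -- For n = 6 every class is a single vertex w p, and A is the adjacency matrix of G in the
  -- coordinates p.
  module _ (X : Hexad) (n≡6 : n ≡ 6) where
    open Positions X

    private
      5≤n : 5 ≤ n
      5≤n = ≤-trans (n≤1+n 5) (≤-reflexive (sym n≡6))

      both-one : ∀ {i j} → n ≡ 2 * (size i + size j) + 2 → size i ≡ 1 × size j ≡ 1
      both-one {i} {j} tight =
        ≤-antisym (+-cancelʳ-≤ 1 (size i) 1 (≤-trans (+-monoʳ-≤ (size i) (1≤size j)) (≤-reflexive sum≡2)))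
                  (1≤size i) ,
        ≤-antisym (+-cancelˡ-≤ 1 (size j) 1 (≤-trans (+-monoˡ-≤ (size j) (1≤size i)) (≤-reflexive sum≡2)))
                  (1≤size j)
        where
        sum≡2 : size i + size j ≡ 2
        sum≡2 = *-cancelˡ-≡ (size i + size j) 2 2
                  (+-cancelʳ-≡ 2 (2 * (size i + size j)) 4 (trans (sym tight) n≡6))

    single : ∀ p → size (ℓ p) ≡ 1
    single 0F = proj₁ (both-one tight₁)
    single 1F = proj₂ (both-one tight₁)
    single 2F = proj₁ (both-one tight₂)
    single 3F = proj₂ (both-one tight₂)
    single 4F = single₄
    single 5F = single₅

    w : Fin 6 → Fin n
    w p = rep (ℓ p)

    w-injective : ∀ {p q} → w p ≡ w q → p ≡ q
    w-injective = ℓ-injective ∘ rep-injective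

    vertex-label : ∀ v → ∃ λ p → v ≡ w p
    vertex-label v with ℓ-surjective (part v)
    ... | p , v∈p = p , singleton-rep (single p) v∈p

    reindex : (f : Fin n → ℕ) → sum f ≡ sum (f ∘ w)
    reindex f = sum-permute f (permutation w (proj₁ ∘ vertex-label) (sym ∘ proj₂ ∘ vertex-label)
                                             (λ p → w-injective (sym (proj₂ (vertex-label (w p))))))

    A : Fin 6 → Fin 6 → Bool
    A p q = E G (w p) (w q)

    A-sym : ∀ p q → A p q ≡ A q p
    A-sym p q = E-sym G (w p) (w q)

    A-irrefl : ∀ p → A p p ≡ false
    A-irrefl p = E-irr G (w p)

    private
      tight : ∀ {p q} → 2 * (size (ℓ p) + size (ℓ q)) + 2 ≤ n
      tight {p} {q} =
        ≤-reflexive (trans (cong₂ (λ x y → 2 * (x + y) + 2) (single p) (single q)) (sym n≡6))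

    degree : ∀ p → ∣ A p ∣ ≡ 3
    degree p with partner-position 5≤n p
    ... | q , p~q = begin
      ∣ A p ∣             ≡⟨ reindex (𝟙 ∘ E G (w p)) ⟨
      ∣ E G (w p) ∣       ≡⟨ deg≡∣E∣ G (w p) ⟨
      deg G (w p)         ≡⟨ coalition-cubic p~q tight (w p) (pair-left (part-rep (ℓ p))) ⟩
      3                   ∎
      where open ≡-Reasoning

    one-in-edge : ∀ {p q} → H (ℓ p) (ℓ q) → ∀ s → s ≢ p → s ≢ q → 𝟙 (A p s) + 𝟙 (A q s) ≡ 1
    one-in-edge {p} {q} p~q s s≢p s≢q = count (A p s) (A q s) refl refl
      where
      deg≡1 : deg-in G (pair (ℓ p) (ℓ q)) (w s) ≡ 1
      deg≡1 = coalition-unique-neighbour p~q tight (w s) (rep-outside s≢p s≢q)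
      count : ∀ a b → A p s ≡ a → A q s ≡ b → 𝟙 a + 𝟙 b ≡ 1
      count true  false _ _ = refl
      count false true  _ _ = refl
      count true  true  ps qs = ⊥-elim (proj₁ p~q (cong ℓ (w-injective
        (unique-neighbour G {pair (ℓ p) (ℓ q)} {w s} {w p} {w q} deg≡1
          (pair-left (part-rep (ℓ p))) ps (pair-right (part-rep (ℓ q))) qs))))
      count false false ps qs =
        let u , u∈pq , u~s = some-neighbour G {pair (ℓ p) (ℓ q)} {w s} deg≡1 in ⊥-elim (
        [ (λ u∈p → not-¬ ps (subst (λ x → Adj G x (w s)) (singleton-rep (single p) u∈p) u~s))
        , (λ u∈q → not-¬ qs (subst (λ x → Adj G x (w s)) (singleton-rep (single q) u∈q) u~s))
        ]′ (pair-sound u∈pq))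

    H⇔dominating-edge : ∀ p q → H (ℓ p) (ℓ q) ⇔ DominatingEdge A p q
    H⇔dominating-edge p q = mk⇔ to from
      where
      at-p : ∀ {u v} → part u ≡ ℓ p → Adj G u v → Adj G (w p) v
      at-p u∈p = subst (λ x → Adj G x _) (singleton-rep (single p) u∈p)
      at-q : ∀ {u v} → part u ≡ ℓ q → Adj G u v → Adj G (w q) v
      at-q u∈q = subst (λ x → Adj G x _) (singleton-rep (single q) u∈q)

      to : H (ℓ p) (ℓ q) → DominatingEdge A p q
      to p~q = proj₁ p~q ∘ cong ℓ , adjacent , dominated
        where
        adjacent : A p q ≡ true
        adjacent = let x , x∈q , p~x = singleton-anchor p~q (single p) in
                   subst (Adj G (w p)) (singleton-rep (single q) x∈q) p~x
        dominated : ∀ s → s ≢ p → s ≢ q → A s p ∨ A s q ≡ true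
        dominated s s≢p s≢q =
          let u , u∈pq , u~s = proj₁ (coalition-cds p~q) (w s) (not-¬ (rep-outside s≢p s≢q)) in
          [ (λ u∈p → cong (_∨ A s q) (Adj-sym G (at-p u∈p u~s)))
          , (λ u∈q → trans (cong (A s p ∨_) (Adj-sym G (at-q u∈q u~s))) (∨-zeroʳ (A s p)))
          ]′ (pair-sound u∈pq)

      from : DominatingEdge A p q → H (ℓ p) (ℓ q)
      from (p≢q , p~q , dom) =
        p≢q ∘ ℓ-injective ,
        small-class-not-cds 5≤n (≤-reflexive (single p)) ,
        small-class-not-cds 5≤n (≤-reflexive (single q)) ,
        dominating , (w p , inj₁ (part-rep (ℓ p))) , connected
        where
        PQ : VSet n
        PQ = Class G part (ℓ p) ∪ Class G part (ℓ q)

        near : ∀ s → s ≢ p → s ≢ q → ∃ λ u → PQ u × Adj G u (w s)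
        near s s≢p s≢q =
          [ (λ sp → w p , inj₁ (part-rep (ℓ p)) , Adj-sym G sp)
          , (λ sq → w q , inj₂ (part-rep (ℓ q)) , Adj-sym G sq)
          ]′ (∨-true (dom s s≢p s≢q))

        dominating : Dominating G PQ
        dominating v v∉PQ with vertex-label v
        ... | s , v≡ws = subst (λ x → ∃ λ u → PQ u × Adj G u x) (sym v≡ws)
                           (near s (v∉PQ ∘ inj₁ ∘ in-class) (v∉PQ ∘ inj₂ ∘ in-class))
          where
          in-class : ∀ {r} → s ≡ r → part v ≡ ℓ r
          in-class {r} refl = trans (cong part v≡ws) (part-rep (ℓ s))

        in-PQ : ∀ {x} → PQ x → x ≡ w p ⊎ x ≡ w q
        in-PQ (inj₁ x∈p) = inj₁ (singleton-rep (single p) x∈p)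
        in-PQ (inj₂ x∈q) = inj₂ (singleton-rep (single q) x∈q)

        link : ∀ {x y} → x ≡ w p ⊎ x ≡ w q → y ≡ w p ⊎ y ≡ w q → PQ x → PQ y → Walk G PQ x y
        link (inj₁ refl) (inj₁ refl) x∈ _  = here x∈
        link (inj₂ refl) (inj₂ refl) x∈ _  = here x∈
        link (inj₁ refl) (inj₂ refl) x∈ y∈ = step x∈ p~q (here y∈)
        link (inj₂ refl) (inj₁ refl) x∈ y∈ = step x∈ (Adj-sym G p~q) (here y∈)

        connected : ∀ x y → PQ x → PQ y → Walk G PQ x y
        connected x y x∈ y∈ = link (in-PQ x∈) (in-PQ y∈) x∈ y∈

    private
      a~b : A 0F 1F ≡ true
      a~b = proj₁ (proj₂ (Equivalence.to (H⇔dominating-edge 0F 1F) pair₁))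

      c~d : A 2F 3F ≡ true
      c~d = proj₁ (proj₂ (Equivalence.to (H⇔dominating-edge 2F 3F) pair₂))

    normalised : A 0F 2F ≡ true → A 0F 4F ≡ true → (H ≅ M6) ⊎ (H ≅ ThreeK2)
    normalised a~c a~e =
      [ (λ A≗prism → inj₂ (≅-of-labelling ℓ ℓ-injective ℓ-surjective λ p q →
           prism-3K₂ p q ⇔-∘ (DominatingEdge-resp A≗prism p q ⇔-∘ H⇔dominating-edge p q)))
      , (λ A≗K₃₃ → inj₁ (≅-of-labelling (ℓ ∘ swap₂₃₄₅)
           (∘transpose-injective 4F 5F (∘transpose-injective 2F 3F ℓ-injective))
           (∘transpose-surjective 4F 5F (∘transpose-surjective 2F 3F ℓ-surjective)) λ p q →
           K₃₃-M₆ p q ⇔-∘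
             (DominatingEdge-resp A≗K₃₃ _ _ ⇔-∘ H⇔dominating-edge (swap₂₃₄₅ p) (swap₂₃₄₅ q))))
      ]′ (CubicSix.prism-or-K₃₃ A A-sym A-irrefl degree (one-in-edge pair₁) (one-in-edge pair₂)
                                         a~b c~d a~c a~e)

  -- Up to relabelling, V_a is adjacent to V_c and to V_e.
  six-vertices : Hexad → n ≡ 6 → (H ≅ M6) ⊎ (H ≅ ThreeK2)
  six-vertices X n≡6 = e-side (A X n≡6 0F 4F) refl
    where
    c-side : (Y : Hexad) → A Y n≡6 0F 4F ≡ true → ∀ b → A Y n≡6 0F 2F ≡ b → (H ≅ M6) ⊎ (H ≅ ThreeK2)
    c-side Y a~e true  a~c = normalised Y n≡6 a~c a~e
    c-side Y a~e false a≁c = normalised (swap₂₃ Y) n≡6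
      (trans (A-sym Y n≡6 0F 3F) (else-second (one-in-edge Y n≡6 (Hexad.pair₂ Y) 0F (λ ()) (λ ()))
                                              (trans (A-sym Y n≡6 2F 0F) a≁c)))
      a~e
    e-side : ∀ b → A X n≡6 0F 4F ≡ b → (H ≅ M6) ⊎ (H ≅ ThreeK2)
    e-side true  a~e = c-side X a~e (A X n≡6 0F 2F) refl
    e-side false a≁e = c-side (swap₀₁ X) b~e (A X n≡6 1F 2F) refl
      where
      b~e : A X n≡6 1F 4F ≡ true
      b~e = else-second (one-in-edge X n≡6 (Hexad.pair₁ X) 4F (λ ()) (λ ())) a≁e

module Classification {n k} (G : Graph n) (subcubic : ∀ u → deg G u ≤ 3)
                      (part : Fin n → Fin (suc k)) (ccp : IsCCPartition G part) (6≤k : 6 ≤ suc k) where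

  open Coalitions G subcubic part ccp

  private
    5≤n : 5 ≤ n
    5≤n = ≤-trans (n≤1+n 5) (≤-trans 6≤k (injective⇒≤ rep-injective))

  hexad-graph : Hexad → (H ≅ M6) ⊎ (H ≅ ThreeK2) ⊎ (H ≅ S22)
  hexad-graph X = by-size (size (ℓ 0F) + size (ℓ 1F) ℕ.≟ 2)
    where
    open Positions X
    by-size : Dec (size (ℓ 0F) + size (ℓ 1F) ≡ 2) → (H ≅ M6) ⊎ (H ≅ ThreeK2) ⊎ (H ≅ S22)
    by-size (yes two) = Sum.map₂ inj₁ (six-vertices X (trans tight₁ (cong (λ m → 2 * m + 2) two)))
    by-size (no ¬two) = inj₂ (inj₂ (hexad-double-star 8≤n X))
      where
      3≤size : 3 ≤ size (ℓ 0F) + size (ℓ 1F)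
      3≤size = ≤∧≢⇒< (+-mono-≤ (1≤size (ℓ 0F)) (1≤size (ℓ 1F))) (¬two ∘ sym)
      8≤n : 8 ≤ n
      8≤n = ≤-trans (+-monoˡ-≤ 2 (*-monoʳ-≤ 2 3≤size)) (≤-reflexive (sym tight₁))

  disjoint-coalitions : ∀ {a b c d} → H a b → H c d → a ≢ c → a ≢ d → b ≢ c → b ≢ d →
                        (H ≅ M6) ⊎ (H ≅ ThreeK2) ⊎ (H ≅ S22)
  disjoint-coalitions hab hcd a≢c a≢d b≢c b≢d = hexad-graph (hexad 6≤k hab hcd a≢c a≢d b≢c b≢d)

  no-universal : (H ≅ M6) ⊎ (H ≅ ThreeK2) ⊎ (H ≅ S22) → ∀ c → ¬ (∀ y → y ≢ c → H y c)
  no-universal (inj₁ φ)        = no-universal-vertex {R = M6} (λ p q → T? _) φ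
  no-universal (inj₂ (inj₁ φ)) = no-universal-vertex {R = ThreeK2} (λ p q → T? _) φ
  no-universal (inj₂ (inj₂ φ)) = no-universal-vertex {R = S22} (λ p q → T? _) φ

  private
    p : Fin (suc k) → Fin (suc k)
    p i = proj₁ (partner 5≤n i)

    i~pi : ∀ i → H i (p i)
    i~pi i = proj₂ (partner 5≤n i)

    no-loop : ∀ i → p i ≢ i
    no-loop i = proj₁ (i~pi i) ∘ sym

  star : (∀ x y → ¬ Apart p x y) → H ≅ Star (suc k)
  star meet = ≅-Star c centred
    where
    hub : ∃ λ c → ∀ y → y ≢ c → p y ≡ c ⊎ p c ≡ y
    hub = common-vertex p no-loop meet zero

    c : Fin (suc k)
    c = proj₁ hub

    universal : ∀ y → y ≢ c → H y c
    universal y y≢c = [ (λ py≡c → subst (H y) py≡c (i~pi y))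
                      , (λ pc≡y → H-sym (subst (H c) pc≡y (i~pi c)))
                      ]′ (proj₂ hub y y≢c)

    -- An edge avoiding c, together with an edge from c to a fourth class, would make H one of
    -- M₆, 3K₂, S₂,₂, none of which has a universal vertex.
    through-c : ∀ {i j} → H i j → i ≡ c ⊎ j ≡ c
    through-c {i} {j} h with i ≟ c | j ≟ c
    ... | yes i≡c | _       = inj₁ i≡c
    ... | no  _   | yes j≡c = inj₂ j≡c
    ... | no  i≢c | no  j≢c with fresh (≤-trans (m≤m+n 4 2) 6≤k) (i ∷ j ∷ c ∷ [])
    ...   | x , x∉ =
      ⊥-elim (no-universal (disjoint-coalitions h (universal x (x∉ ∘ there ∘ there ∘ here))
                              (x∉ ∘ here ∘ sym) i≢c (x∉ ∘ there ∘ here ∘ sym) j≢c) c universal)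

    centred : ∀ i j → H i j ⇔ (i ≢ j × (i ≡ c ⊎ j ≡ c))
    centred i j = mk⇔ (λ h → proj₁ h , through-c h)
                      (λ { (i≢j , inj₁ refl) → H-sym (universal j (i≢j ∘ sym))
                         ; (i≢j , inj₂ refl) → universal i i≢j })

  classification : (H ≅ M6) ⊎ (H ≅ ThreeK2) ⊎ (H ≅ S22) ⊎ (H ≅ Star (suc k))
  classification with any? (λ x → any? (λ y → apart? p x y))
  ... | yes (x , y , x≢y , x≢py , px≢y , px≢py) =
    Sum.map₂ (Sum.map₂ inj₁) (disjoint-coalitions (i~pi x) (i~pi y) x≢y x≢py px≢y px≢py)
  ... | no none = inj₂ (inj₂ (inj₂ (star (λ x y apart → none (x , y , apart)))))

lemma9 : ∀ {n k} (G : Graph n) → Subcubic G → (part : Fin n → Fin k) →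
    IsCCPartition G part → 6 ≤ k →
    (CCG G part ≅ M6) ⊎ (CCG G part ≅ ThreeK2) ⊎ (CCG G part ≅ S22) ⊎ (CCG G part ≅ Star k)
lemma9 {k = suc k} G (_ , subcubic) part ccp 6≤k = Classification.classification G subcubic part ccp 6≤k
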